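{- Let $\mathcal{C}$ be a permutation class whose longest simple permutations have length $k$ (so $\mathcal{C}$ contains only finitely many simple permutations). Then every basis element of the substitution-closure $\langle \mathcal{C}\rangle$ has length at most $k+2$.
   Context: A sequence is order isomorphic to a permutation $\sigma$ if its entries are in the same relative order as those of $\sigma$. A permutation $\pi$ contains $\sigma$ (written $\sigma\le\pi$) if $\pi$ has a subsequence order isomorphic to $\sigma$. A permutation class is a set of permutations closed downward under this containment order. The basis of a class $\mathcal{C}$ is the smallest set $B$ with $\mathcal{C}=\{\pi: \beta\not\le\pi \text{ for all } \beta\in B\}$, i.e. the set of minimal permutations not in $\mathcal{C}$. An interval of $\pi$ is a set of contiguous positions whose values form a set of contiguous integers; a permutation of length $n$ is simple if its only intervals have length $0$, $1$ or $n$. Given $\sigma$ of length $m$ and nonempty permutations $\alpha_1,\dots,\alpha_m$, the inflation $\sigma[\alpha_1,\dots,\alpha_m]$ is obtained by replacing each entry $\sigma(i)$ by an interval order isomorphic to $\alpha_i$. A class $\mathcal{C}$ is substitution-closed if $\sigma[\alpha_1,\dots,\alpha_m]\in\mathcal{C}$ whenever $\sigma,\alpha_1,\dots,\alpha_m\in\mathcal{C}$; the substitution-closure $\langle X\rangle$ of a set $X$ of permutations is the smallest substitution-closed permutation class containing $X$. -}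

module Defs where

open import Level using (Level; _⊔_) renaming (suc to lsuc; zero to lzero)
open import Data.Nat using (ℕ; zero; suc; _+_; _∸_) renaming (_≤_ to _≤ℕ_; _<_ to _<ℕ_)
open import Data.Fin using (Fin; toℕ; _<_; _≤_)
open import Data.Product using (Σ; ∃; _×_; _,_)
open import Data.Sum using (_⊎_)
open import Relation.Binary.PropositionalEquality using (_≡_; _≢_)
open import Relation.Nullary using (¬_)
open import Function.Definitions using (Injective)

-- A permutation of length len: a injective (hence bijective) map on Fin len,
-- position i ↦ value fn i.
record Perm : Set where
  constructor perm
  field
    len : ℕ
    fn  : Fin len → Fin len
    inj : Injective _≡_ _≡_ fn
open Perm public

_≼_ : Perm → Perm → Set
σ ≼ π = Σ (Fin (len σ) → Fin (len π)) λ g →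
          (∀ i j → i < j → g i < g j) ×
          (∀ i j → (fn σ i < fn σ j → fn π (g i) < fn π (g j))
                 × (fn π (g i) < fn π (g j) → fn σ i < fn σ j))

IsClass : {ℓ : Level} → (Perm → Set ℓ) → Set ℓ
IsClass C = ∀ σ π → σ ≼ π → C π → C σ

-- Positions a, a+1, …, b-1 of π form an interval: their values are contiguous,
-- i.e. all lie in [c, c + (b - a)) for some c (π being injective).
IsInterval : Perm → ℕ → ℕ → Set
IsInterval π a b = (a ≤ℕ b) × (b ≤ℕ len π) ×
  ∃ λ c → ∀ (p : Fin (len π)) → a ≤ℕ toℕ p → toℕ p <ℕ b →
            (c ≤ℕ toℕ (fn π p)) × (toℕ (fn π p) <ℕ c + (b ∸ a))

Simple : Perm → Set
Simple π = ∀ a b → IsInterval π a b → (b ∸ a ≤ℕ 1) ⊎ (b ∸ a ≡ len π)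

-- π is (order isomorphic to) the inflation σ[α₀,…,α_{m-1}].
-- blk p is the block (entry of σ) that position p of π belongs to; blocks occur
-- left to right in order, entries in different blocks compare as the
-- corresponding entries of σ, and block i (enumerated increasingly by e) is
-- order isomorphic to α i.
IsInflation : (σ : Perm) → (Fin (len σ) → Perm) → Perm → Set
IsInflation σ α π =
  Σ (Fin (len π) → Fin (len σ)) λ blk →
    (∀ p q → p ≤ q → blk p ≤ blk q) ×
    (∀ p q → blk p ≢ blk q →
        (fn π p < fn π q → fn σ (blk p) < fn σ (blk q)) ×
        (fn σ (blk p) < fn σ (blk q) → fn π p < fn π q)) ×
    (∀ i → Σ (Fin (len (α i)) → Fin (len π)) λ e →
        (∀ j → blk (e j) ≡ i) ×
        (∀ p → blk p ≡ i → ∃ λ j → e j ≡ p) ×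
        (∀ j j' → j < j' → e j < e j') ×
        (∀ j j' → (fn (α i) j < fn (α i) j' → fn π (e j) < fn π (e j')) ×
                  (fn π (e j) < fn π (e j') → fn (α i) j < fn (α i) j')))

SubstClosed : {ℓ : Level} → (Perm → Set ℓ) → Set ℓ
SubstClosed C = ∀ σ (α : Fin (len σ) → Perm) π →
  C σ → (∀ i → C (α i)) → (∀ i → 0 <ℕ len (α i)) → IsInflation σ α π → C π

SubstClosure : (Perm → Set) → Perm → Set₁
SubstClosure X π = ∀ (D : Perm → Set) → IsClass D → SubstClosed D →
                     (∀ σ → X σ → D σ) → D π

InBasis : {ℓ : Level} → (Perm → Set ℓ) → Perm → Set ℓ
InBasis D β = ¬ D β × (∀ γ → γ ≼ β → len γ <ℕ len β → D γ)

LongestSimpleLength : (Perm → Set) → ℕ → Set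
LongestSimpleLength C k =
  (∃ λ π → C π × Simple π × len π ≡ k) ×
  (∀ π → C π → Simple π → len π ≤ℕ k)

-- A basis element β of ⟨C⟩ is simple: a nontrivial interval of β exhibits it as an inflation of
-- shorter permutations, which lie in ⟨C⟩ by minimality. A simple permutation of ⟨C⟩ lies in C,
-- since the permutations all of whose simple patterns lie in C form a substitution-closed class
-- containing C. Finally, as in the Schmerl–Trotter theorem, a simple permutation of length n ≥ 5
-- contains a simple pattern 2413 or 3142, which can be grown one or two points at a time, keeping it
-- simple, until at most two points are missing. So if len β > k + 2, β has a proper simple pattern
-- of length > k; it lies in ⟨C⟩, hence in C, contradicting the choice of k.
--
-- Simplicity is handled as primality of the set of points for the pair of strict orders
-- (position, value): a set is prime if its only modules, subsets seen uniformly from outside, are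
-- trivial. The argument is classical; as the goal is decidable, existence is stated under ¬ ¬.

module Submission where

open import Defs
open import Data.Nat as ℕ using (ℕ; zero; suc; _+_; _∸_; _≤_; _<_; z≤n; s≤s; _<ᵇ_)
open import Data.Nat.Properties as ℕP using ()
open import Data.Fin as F using (Fin; toℕ; punchOut; fromℕ<)
open import Data.Fin.Properties as FP using (any?; all?; _≟_)
open import Data.Bool using (Bool; true; false; not; _∧_; _∨_; if_then_else_; T)
open import Relation.Binary.Definitions using (tri<; tri≈; tri>)
open import Data.Bool.Properties using () renaming (_≟_ to _≟B_)
open import Data.Product using (Σ; ∃; _×_; _,_; proj₁; proj₂)
open import Data.Product.Properties using (≡-dec)
open import Data.Sum using (_⊎_; inj₁; inj₂; [_,_])
open import Data.Empty using (⊥; ⊥-elim)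
open import Relation.Nullary using (¬_; Dec; yes; no; does; _×-dec_; _→-dec_; ¬?)
open import Relation.Nullary.Decidable using (decidable-stable; ¬¬-excluded-middle)
open import Relation.Binary.PropositionalEquality using (_≡_; _≢_; refl; sym; trans; cong; cong₂; subst; subst₂; module ≡-Reasoning)
open import Function.Definitions using (Injective)

bool-case : {A : Set} (b : Bool) → (b ≡ true → A) → (b ≡ false → A) → A
bool-case true t f = t refl
bool-case false t f = f refl

true≢false : {b : Bool} → b ≡ true → b ≡ false → ⊥
true≢false refl ()

eqb : {N : ℕ} → Fin N → Fin N → Bool
eqb p q = does (p ≟ q)

eqb-refl : {N : ℕ} (p : Fin N) → eqb p p ≡ true
eqb-refl p with p ≟ p
... | yes _ = refl
... | no ne = ⊥-elim (ne refl)

eqb-true : {N : ℕ} {p q : Fin N} → eqb p q ≡ true → p ≡ q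
eqb-true {p = p} {q} e with p ≟ q
... | yes pq = pq
eqb-true {p = p} {q} () | no _

eqb-false : {N : ℕ} {p q : Fin N} → p ≢ q → eqb p q ≡ false
eqb-false {p = p} {q} ne with p ≟ q
... | yes pq = ⊥-elim (ne pq)
... | no _ = refl

∨-trueˡ : {a b : Bool} → a ≡ true → (a ∨ b) ≡ true
∨-trueˡ refl = refl
∨-trueʳ : {a b : Bool} → b ≡ true → (a ∨ b) ≡ true
∨-trueʳ {true} refl = refl
∨-trueʳ {false} refl = refl
∨-true-elim : {a b : Bool} → (a ∨ b) ≡ true → (a ≡ true) ⊎ (b ≡ true)
∨-true-elim {true} _ = inj₁ refl
∨-true-elim {false} e = inj₂ e
∨-false : {a b : Bool} → a ≡ false → b ≡ false → (a ∨ b) ≡ false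
∨-false refl refl = refl
∧-true : {a b : Bool} → a ≡ true → b ≡ true → (a ∧ b) ≡ true
∧-true refl refl = refl
∧-true-elim : {a b : Bool} → (a ∧ b) ≡ true → (a ≡ true) × (b ≡ true)
∧-true-elim {true} {true} _ = refl , refl
∧-falseˡ : {a b : Bool} → a ≡ false → (a ∧ b) ≡ false
∧-falseˡ refl = refl
∧-falseʳ : {a b : Bool} → b ≡ false → (a ∧ b) ≡ false
∧-falseʳ {true} refl = refl
∧-falseʳ {false} refl = refl
not-false : {a : Bool} → a ≡ false → not a ≡ true
not-false refl = refl
not-true : {a : Bool} → a ≡ true → not a ≡ false
not-true refl = refl
not-true-elim : {a : Bool} → not a ≡ true → a ≡ false
not-true-elim {false} _ = refl
not-false-elim : {a : Bool} → not a ≡ false → a ≡ true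
not-false-elim {true} _ = refl

count : {N : ℕ} → (Fin N → Bool) → ℕ
count {zero} X = 0
count {suc N} X = (if X F.zero then 1 else 0) + count (λ i → X (F.suc i))

injective⇒surjective : {n : ℕ} (f : Fin n → Fin n) → Injective _≡_ _≡_ f → ∀ y → ∃ λ x → f x ≡ y
injective⇒surjective {n} f inj y with any? (λ x → f x ≟ y)
... | yes e = e
injective⇒surjective {suc n} f inj y | no ne =
  ⊥-elim (ℕP.<-irrefl refl (FP.injective⇒≤ {f = g} ginj))
  where
  g : Fin (suc n) → Fin n
  g x = punchOut {i = y} (λ e → ne (x , sym e))
  ginj : Injective _≡_ _≡_ g
  ginj {x} {x'} e = inj (FP.punchOut-injective (λ e → ne (x , sym e)) (λ e → ne (x' , sym e)) e)

<⇒<ᵇ≡true : {m n : ℕ} → m < n → (m <ᵇ n) ≡ true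
<⇒<ᵇ≡true {m} {n} lt with m <ᵇ n | ℕP.<⇒<ᵇ lt
... | true | _ = refl

<ᵇ≡true⇒< : {m n : ℕ} → (m <ᵇ n) ≡ true → m < n
<ᵇ≡true⇒< {m} {n} e = ℕP.<ᵇ⇒< m n (subst-T e)
  where
  subst-T : {b : Bool} → b ≡ true → T b
  subst-T refl = _

≤⇒<ᵇ≡false : {m n : ℕ} → n ≤ m → (m <ᵇ n) ≡ false
≤⇒<ᵇ≡false {m} {n} le with m <ᵇ n in e
... | false = refl
... | true = ⊥-elim (ℕP.<-irrefl refl (ℕP.<-≤-trans (<ᵇ≡true⇒< e) le))

<ᵇ≡false⇒≤ : {m n : ℕ} → (m <ᵇ n) ≡ false → n ≤ m
<ᵇ≡false⇒≤ {m} {n} e with ℕP.<-cmp m n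
... | tri< a _ _ = ⊥-elim (true≢false (<⇒<ᵇ≡true a) e)
... | tri≈ _ b _ = ℕP.≤-reflexive (sym b)
... | tri> _ _ c = ℕP.<⇒≤ c

case-≟ : {N : ℕ} {A : Set} (p q : Fin N) → (p ≡ q → A) → (p ≢ q → A) → A
case-≟ p q y n with p ≟ q
... | yes e = y e
... | no ne = n ne

does-true⇒ : {P : Set} (d : Dec P) → does d ≡ true → P
does-true⇒ (yes p) _ = p
does-true⇒ (no _) ()

⇒does-true : {P : Set} (d : Dec P) → P → does d ≡ true
⇒does-true (yes _) _ = refl
⇒does-true (no np) p = ⊥-elim (np p)

count-mono : ∀ {N} (P Q : Fin N → Bool) → (∀ q → P q ≡ true → Q q ≡ true) → count P ≤ count Q
count-mono {zero} P Q s = z≤n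
count-mono {suc N} P Q s with P F.zero in e1 | Q F.zero in e2
... | true | true = s≤s (count-mono (λ i → P (F.suc i)) (λ i → Q (F.suc i)) (λ q → s (F.suc q)))
... | true | false = ⊥-elim (true≢false (s F.zero e1) e2)
... | false | true = ℕP.m≤n⇒m≤1+n (count-mono (λ i → P (F.suc i)) (λ i → Q (F.suc i)) (λ q → s (F.suc q)))
... | false | false = count-mono (λ i → P (F.suc i)) (λ i → Q (F.suc i)) (λ q → s (F.suc q))

count-strict : ∀ {N} (P Q : Fin N → Bool) → (∀ q → P q ≡ true → Q q ≡ true) →
               ∀ u → P u ≡ false → Q u ≡ true → count P < count Q
count-strict {suc N} P Q s F.zero Pu Qu rewrite Pu | Qu =
  s≤s (count-mono (λ i → P (F.suc i)) (λ i → Q (F.suc i)) (λ q → s (F.suc q)))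
count-strict {suc N} P Q s (F.suc u) Pu Qu with P F.zero in e1 | Q F.zero in e2
... | true | true = s≤s (count-strict (λ i → P (F.suc i)) (λ i → Q (F.suc i)) (λ q → s (F.suc q)) u Pu Qu)
... | true | false = ⊥-elim (true≢false (s F.zero e1) e2)
... | false | true = ℕP.m≤n⇒m≤1+n (count-strict (λ i → P (F.suc i)) (λ i → Q (F.suc i)) (λ q → s (F.suc q)) u Pu Qu)
... | false | false = count-strict (λ i → P (F.suc i)) (λ i → Q (F.suc i)) (λ q → s (F.suc q)) u Pu Qu

max-element : ∀ {N} (X : Fin N → Bool) → ∀ p → X p ≡ true →
         Σ (Fin N) λ x → (X x ≡ true) × (∀ y → X y ≡ true → toℕ y ≤ toℕ x)
max-element {suc N} X p Xp with any? (λ i → X (F.suc i) ≟B true)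
... | yes (i , Xi) with max-element (λ j → X (F.suc j)) i Xi
... | x , Xx , mx = F.suc x , Xx , f
  where
  f : ∀ y → X y ≡ true → toℕ y ≤ toℕ (F.suc x)
  f F.zero _ = z≤n
  f (F.suc y) e = s≤s (mx y e)
max-element {suc N} X p Xp | no ne = F.zero , z0 p Xp , f
  where
  z0 : ∀ q → X q ≡ true → X F.zero ≡ true
  z0 F.zero e = e
  z0 (F.suc q) e = ⊥-elim (ne (q , e))
  f : ∀ y → X y ≡ true → toℕ y ≤ 0
  f F.zero _ = z≤n
  f (F.suc y) e = ⊥-elim (ne (y , e))

count≤size : ∀ {N} (X : Fin N → Bool) → count X ≤ N
count≤size {zero} X = z≤n
count≤size {suc N} X with X F.zero
... | true = s≤s (count≤size (λ i → X (F.suc i)))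
... | false = ℕP.m≤n⇒m≤1+n (count≤size (λ i → X (F.suc i)))

count-empty : ∀ {N} → count {N} (λ _ → false) ≡ 0
count-empty {zero} = refl
count-empty {suc N} = count-empty {N}

count>0⇒nonempty : ∀ {N} (X : Fin N → Bool) → 1 ≤ count X → ∃ λ a → X a ≡ true
count>0⇒nonempty {suc N} X le with X F.zero in e
... | true = F.zero , e
... | false with count>0⇒nonempty (λ i → X (F.suc i)) le
... | a , Xa = F.suc a , Xa

count-∨ : ∀ {N} (P Q : Fin N → Bool) → count (λ q → P q ∨ Q q) ≤ count P + count Q
count-∨ {zero} P Q = z≤n
count-∨ {suc N} P Q with P F.zero | Q F.zero
... | true | true = s≤s (ℕP.≤-trans (count-∨ (λ i → P (F.suc i)) (λ i → Q (F.suc i)))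
                        (ℕP.≤-trans (ℕP.m≤n+m _ 1) (ℕP.≤-reflexive (sym (ℕP.+-suc _ _)))))
... | true | false = s≤s (count-∨ (λ i → P (F.suc i)) (λ i → Q (F.suc i)))
... | false | true = ℕP.≤-trans (s≤s (count-∨ (λ i → P (F.suc i)) (λ i → Q (F.suc i)))) (ℕP.≤-reflexive (sym (ℕP.+-suc _ _)))
... | false | false = count-∨ (λ i → P (F.suc i)) (λ i → Q (F.suc i))

count-singleton : ∀ {N} (a : Fin N) → count (λ q → eqb q a) ≤ 1
count-singleton {suc N} F.zero = s≤s (ℕP.≤-reflexive (count-empty {N}))
count-singleton {suc N} (F.suc a) = count-singleton a

count-all : ∀ {N} → count {N} (λ _ → true) ≡ N
count-all {zero} = refl
count-all {suc N} = cong suc (count-all {N})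

count-compl : ∀ {N} (X : Fin N → Bool) → count X + count (λ q → not (X q)) ≡ N
count-compl {zero} X = refl
count-compl {suc N} X with X F.zero
... | true = cong suc (count-compl (λ i → X (F.suc i)))
... | false = trans (ℕP.+-suc _ _) (cong suc (count-compl (λ i → X (F.suc i))))

min-element-by : ∀ {N} (key : Fin N → ℕ) (X : Fin N → Bool) → ∀ p → X p ≡ true →
        Σ (Fin N) λ x → (X x ≡ true) × (∀ y → X y ≡ true → key x ≤ key y)
min-element-by {suc N} key X p Xp with any? (λ i → X (F.suc i) ≟B true)
... | no ne = F.zero , z0 p Xp , f
  where
  z0 : ∀ q → X q ≡ true → X F.zero ≡ true
  z0 F.zero e = e
  z0 (F.suc q) e = ⊥-elim (ne (q , e))
  f : ∀ y → X y ≡ true → key F.zero ≤ key y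
  f F.zero _ = ℕP.≤-refl
  f (F.suc y) e = ⊥-elim (ne (y , e))
... | yes (i , Xi) with min-element-by (λ j → key (F.suc j)) (λ j → X (F.suc j)) i Xi
... | x , Xx , mx with X F.zero in e0
... | false = F.suc x , Xx , f
  where
  f : ∀ y → X y ≡ true → key (F.suc x) ≤ key y
  f F.zero e = ⊥-elim (true≢false e e0)
  f (F.suc y) e = mx y e
... | true with key F.zero ℕ.≤? key (F.suc x)
... | yes le = F.zero , e0 , f
  where
  f : ∀ y → X y ≡ true → key F.zero ≤ key y
  f F.zero _ = ℕP.≤-refl
  f (F.suc y) e = ℕP.≤-trans le (mx y e)
... | no gt = F.suc x , Xx , f
  where
  f : ∀ y → X y ≡ true → key (F.suc x) ≤ key y
  f F.zero _ = ℕP.<⇒≤ (ℕP.≰⇒> gt)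
  f (F.suc y) e = mx y e

-- Pairs of strict total orders: modules and prime sets

record StrictTotalᵇ {N : ℕ} (ℓ : Fin N → Fin N → Bool) : Set where
  field
    irrefl : ∀ p → ℓ p p ≡ false
    swap : ∀ p q → p ≢ q → ℓ q p ≡ not (ℓ p q)
    transitive : ∀ p q r → ℓ p q ≡ true → ℓ q r ≡ true → ℓ p r ≡ true

module _ {N : ℕ} {ℓ : Fin N → Fin N → Bool} (o : StrictTotalᵇ ℓ) where
  open StrictTotalᵇ o

  true⇒≢ : ∀ {p q} → ℓ p q ≡ true → p ≢ q
  true⇒≢ {p} e refl = true≢false e (irrefl p)

  true⇒swap-false : ∀ {p q} → ℓ p q ≡ true → ℓ q p ≡ false
  true⇒swap-false {p} {q} e = trans (swap p q (true⇒≢ e)) (cong not e)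

  false⇒swap-true : ∀ {p q} → p ≢ q → ℓ p q ≡ false → ℓ q p ≡ true
  false⇒swap-true {p} {q} p≢q e = trans (swap p q p≢q) (not-false e)

injective-order : ∀ {n m} (g : Fin n → Fin m) → Injective _≡_ _≡_ g → StrictTotalᵇ (λ p q → toℕ (g p) <ᵇ toℕ (g q))
injective-order g inj = record { irrefl = λ p → ≤⇒<ᵇ≡false {toℕ (g p)} {toℕ (g p)} ℕP.≤-refl ; swap = swap ; transitive = transitive }
  where
  swap : ∀ p q → p ≢ q → (toℕ (g q) <ᵇ toℕ (g p)) ≡ not (toℕ (g p) <ᵇ toℕ (g q))
  swap p q ne with ℕP.<-cmp (toℕ (g p)) (toℕ (g q))
  ... | tri< a _ _ rewrite <⇒<ᵇ≡true a = ≤⇒<ᵇ≡false (ℕP.<⇒≤ a)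
  ... | tri≈ _ b _ = ⊥-elim (ne (inj (FP.toℕ-injective b)))
  ... | tri> _ _ c rewrite ≤⇒<ᵇ≡false (ℕP.<⇒≤ c) = <⇒<ᵇ≡true c
  transitive : ∀ p q r → (toℕ (g p) <ᵇ toℕ (g q)) ≡ true → (toℕ (g q) <ᵇ toℕ (g r)) ≡ true → (toℕ (g p) <ᵇ toℕ (g r)) ≡ true
  transitive p q r a b = <⇒<ᵇ≡true (ℕP.<-trans (<ᵇ≡true⇒< {toℕ (g p)} {toℕ (g q)} a) (<ᵇ≡true⇒< {toℕ (g q)} {toℕ (g r)} b))

before : {N : ℕ} → Fin N → Fin N → Bool
before p q = toℕ p <ᵇ toℕ q

before-order : {N : ℕ} → StrictTotalᵇ (before {N})
before-order = injective-order (λ p → p) (λ e → e)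

opposite : Bool × Bool → Bool × Bool
opposite (a , b) = (not a , not b)

module TwoOrders {N : ℕ} (below : Fin N → Fin N → Bool) (below-order : StrictTotalᵇ below) where
  Point : Set
  Point = Fin N
  Subset : Set
  Subset = Fin N → Bool

  rel : Point → Point → Bool × Bool
  rel p q = (before p q , below p q)

  rel-swap : ∀ {p q} → p ≢ q → rel q p ≡ opposite (rel p q)
  rel-swap {p} {q} ne = cong₂ _,_ (StrictTotalᵇ.swap before-order p q ne) (StrictTotalᵇ.swap below-order p q ne)

  rel-flip : ∀ {z a b} → z ≢ a → z ≢ b → rel z a ≡ rel z b → rel a z ≡ rel b z
  rel-flip {z} {a} {b} na nb e = trans (rel-swap na) (trans (cong opposite e) (sym (rel-swap nb)))

  infix 4 _⊆_
  _⊆_ : Subset → Subset → Set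
  M ⊆ X = ∀ p → M p ≡ true → X p ≡ true

  IsModule : Subset → Subset → Set
  IsModule X M = ∀ z m m' → X z ≡ true → M z ≡ false → M m ≡ true → M m' ≡ true → rel z m ≡ rel z m'

  Prime : Subset → Set
  Prime X = ∀ M m m' p → M ⊆ X → IsModule X M → M m ≡ true → M m' ≡ true → m ≢ m' →
            X p ≡ true → M p ≡ false → ⊥

  full : Subset
  full _ = true

  insert : Point → Subset → Subset
  insert u X p = X p ∨ eqb p u

  insert-new : ∀ u X → insert u X u ≡ true
  insert-new u X = ∨-trueʳ {X u} (eqb-refl u)
  insert-old : ∀ {u X p} → X p ≡ true → insert u X p ≡ true
  insert-old e = ∨-trueˡ e
  insert-elim : ∀ {u X p} → insert u X p ≡ true → (X p ≡ true) ⊎ (p ≡ u)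
  insert-elim e with ∨-true-elim e
  ... | inj₁ a = inj₁ a
  ... | inj₂ b = inj₂ (eqb-true b)

  Uniform : Subset → Point → Set
  Uniform X u = ∀ m m' → X m ≡ true → X m' ≡ true → rel u m ≡ rel u m'

  Clone : Subset → Point → Point → Set
  Clone X x u = ∀ z → X z ≡ true → z ≢ x → rel z x ≡ rel z u

  record ThreePoints (X : Subset) : Set where
    constructor three
    field
      a b c : Point
      Xa : X a ≡ true
      Xb : X b ≡ true
      Xc : X c ≡ true
      ab : a ≢ b
      ac : a ≢ c
      bc : b ≢ c

  two-others : ∀ {X} → ThreePoints X → ∀ x → Σ Point λ y → Σ Point λ z →
               (X y ≡ true) × (X z ≡ true) × (y ≢ x) × (z ≢ x) × (y ≢ z)
  two-others (three a b c Xa Xb Xc ab ac bc) x with x ≟ a | x ≟ b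
  ... | yes refl | _ = b , c , Xb , Xc , (λ e → ab (sym e)) , (λ e → ac (sym e)) , bc
  ... | no _ | yes refl = a , c , Xa , Xc , ab , (λ e → bc (sym e)) , ac
  ... | no na | no nb = a , b , Xa , Xb , (λ e → na (sym e)) , (λ e → nb (sym e)) , ab

  third : ∀ {X} → ThreePoints X → ∀ x x' → Σ Point λ z → (X z ≡ true) × (z ≢ x) × (z ≢ x')
  third T x x' with two-others T x
  ... | y , z , Xy , Xz , yx , zx , yz with y ≟ x'
  ... | yes refl = z , Xz , zx , (λ e → yz (sym e))
  ... | no yx' = y , Xy , yx , yx'

  ThreePoints-mono : ∀ {X Y} → X ⊆ Y → ThreePoints X → ThreePoints Y
  ThreePoints-mono s (three a b c Xa Xb Xc ab ac bc) = three a b c (s a Xa) (s b Xb) (s c Xc) ab ac bc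

  pair : Point → Point → Subset
  pair p q r = eqb r p ∨ eqb r q

  pair-elim : ∀ {p q r} → pair p q r ≡ true → (r ≡ p) ⊎ (r ≡ q)
  pair-elim {p} {q} {r} e with ∨-true-elim {eqb r p} e
  ... | inj₁ rp = inj₁ (eqb-true rp)
  ... | inj₂ rq = inj₂ (eqb-true rq)

  pair-prime : ∀ p q → Prime (pair p q)
  pair-prime p q M m m' r M⊆ _ Mm Mm' m≢m' Yr Mr
    with pair-elim {p} {q} {m} (M⊆ m Mm) | pair-elim {p} {q} {m'} (M⊆ m' Mm') | pair-elim {p} {q} {r} Yr
  ... | inj₁ refl | inj₁ refl | _ = m≢m' refl
  ... | inj₂ refl | inj₂ refl | _ = m≢m' refl
  ... | inj₁ refl | _ | inj₁ refl = true≢false Mm Mr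
  ... | inj₂ refl | _ | inj₂ refl = true≢false Mm Mr
  ... | _ | inj₁ refl | inj₁ refl = true≢false Mm' Mr
  ... | _ | inj₂ refl | inj₂ refl = true≢false Mm' Mr

  count-pair : ∀ {p q} → p ≢ q → 2 ≤ count (pair p q)
  count-pair {p} {q} p≢q = ℕP.<-≤-trans (s≤s p∈) (count-strict (λ r → eqb r p) (pair p q) (λ _ → ∨-trueˡ)
                             q (eqb-false (λ e → p≢q (sym e))) (∨-trueʳ {eqb q p} (eqb-refl q)))
    where
    p∈ : 1 ≤ count (λ r → eqb r p)
    p∈ = subst (_< count (λ r → eqb r p)) (count-empty {N})
           (count-strict (λ _ → false) (λ r → eqb r p) (λ _ ()) p refl (eqb-refl p))

  no-pair-module : ∀ {X x x'} → Prime X → ThreePoints X → X x ≡ true → X x' ≡ true → x ≢ x' →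
       (∀ z → X z ≡ true → z ≢ x → z ≢ x' → rel z x ≡ rel z x') → ⊥
  no-pair-module {X} {x} {x'} P T Xx Xx' x≢x' same with third T x x'
  ... | p , Xp , p≢x , p≢x' = P (pair x x') x x' p pair⊆X pair-module (∨-trueˡ (eqb-refl x)) (∨-trueʳ {eqb x' x} (eqb-refl x'))
                                x≢x' Xp (∨-false (eqb-false p≢x) (eqb-false p≢x'))
    where
    pair⊆X : pair x x' ⊆ X
    pair⊆X q e with pair-elim {x} {x'} {q} e
    ... | inj₁ refl = Xx
    ... | inj₂ refl = Xx'
    ∉pair : ∀ {q} → pair x x' q ≡ false → (q ≢ x) × (q ≢ x')
    ∉pair {q} e = (λ { refl → true≢false (∨-trueˡ {b = eqb q x'} (eqb-refl q)) e }) ,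
                  (λ { refl → true≢false (∨-trueʳ {eqb q x} (eqb-refl q)) e })
    pair-module : IsModule X (pair x x')
    pair-module z m m' Xz Mz Mm Mm' with ∉pair {z} Mz | pair-elim {x} {x'} {m} Mm | pair-elim {x} {x'} {m'} Mm'
    ... | _ | inj₁ refl | inj₁ refl = refl
    ... | _ | inj₂ refl | inj₂ refl = refl
    ... | z≢x , z≢x' | inj₁ refl | inj₂ refl = same z Xz z≢x z≢x'
    ... | z≢x , z≢x' | inj₂ refl | inj₁ refl = sym (same z Xz z≢x z≢x')

  no-co-point-module : ∀ {X x'} → Prime X → ThreePoints X → X x' ≡ true →
       (∀ z z' → X z ≡ true → X z' ≡ true → z ≢ x' → z' ≢ x' → rel x' z ≡ rel x' z') → ⊥
  no-co-point-module {X} {x'} P T Xx' h with two-others T x'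
  ... | y , z , Xy , Xz , yx , zx , yz =
        P M y z x' sub mod (∧-true Xy (not-false (eqb-false yx))) (∧-true Xz (not-false (eqb-false zx))) yz Xx'
          (∧-falseʳ {X x'} (not-true (eqb-refl x')))
    where
    M : Subset
    M q = X q ∧ not (eqb q x')
    sub : M ⊆ X
    sub q e = proj₁ (∧-true-elim e)
    M-elim : ∀ {q} → M q ≡ true → q ≢ x'
    M-elim {q} e refl = true≢false (proj₂ (∧-true-elim {X q} e)) (not-true (eqb-refl q))
    mod : IsModule X M
    mod z m m' Xz Mz Mm Mm' = case-≟ z x' (λ { refl → h m m' (sub m Mm) (sub m' Mm') (M-elim {m} Mm) (M-elim {m'} Mm') })
       (λ zx' → ⊥-elim (true≢false (∧-true Xz (not-false (eqb-false zx'))) Mz))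

  no-uniform-clone : ∀ {X x u} → Prime X → ThreePoints X → X x ≡ true → X u ≡ false → Clone X x u → Uniform X u → ⊥
  no-uniform-clone {X} {x} {u} P T Xx Xu x-clone u-uniform = no-co-point-module P T Xx same
    where
    ≢u : ∀ {z} → X z ≡ true → z ≢ u
    ≢u Xz refl = true≢false Xz Xu
    same : ∀ z z' → X z ≡ true → X z' ≡ true → z ≢ x → z' ≢ x → rel x z ≡ rel x z'
    same z z' Xz Xz' z≢x z'≢x = begin
      rel x z              ≡⟨ rel-swap z≢x ⟩
      opposite (rel z x)   ≡⟨ cong opposite (x-clone z Xz z≢x) ⟩
      opposite (rel z u)   ≡⟨ sym (rel-swap (≢u Xz)) ⟩
      rel u z              ≡⟨ u-uniform z z' Xz Xz' ⟩
      rel u z'             ≡⟨ rel-swap (≢u Xz') ⟩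
      opposite (rel z' u)  ≡⟨ cong opposite (sym (x-clone z' Xz' z'≢x)) ⟩
      opposite (rel z' x)  ≡⟨ sym (rel-swap z'≢x) ⟩
      rel x z'             ∎
      where open ≡-Reasoning

  module-restrict : ∀ {X Y M} → X ⊆ Y → IsModule Y M → IsModule X (λ q → M q ∧ X q)
  module-restrict {X} {Y} {M} s md z m m' Xz Mz Mm Mm' =
    md z m m' (s z Xz) (bool-case (M z) (λ e → ⊥-elim (true≢false (∧-true e Xz) Mz)) (λ e → e))
       (proj₁ (∧-true-elim Mm)) (proj₁ (∧-true-elim Mm'))

  module-meets-prime-once : ∀ {X Y M p0} → Prime X → X ⊆ Y → IsModule Y M → X p0 ≡ true → M p0 ≡ false →
              ∀ a b → M a ≡ true → X a ≡ true → M b ≡ true → X b ≡ true → a ≡ b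
  module-meets-prime-once {X} {Y} {M} {p0} P s md Xp0 Mp0 a b Ma Xa Mb Xb =
    case-≟ a b (λ e → e) (λ ne → ⊥-elim (P (λ q → M q ∧ X q) a b p0 (λ q e → proj₂ (∧-true-elim {M q} e))
      (module-restrict {X} {Y} {M} s md) (∧-true Ma Xa) (∧-true Mb Xb) ne Xp0 (∧-falseˡ Mp0)))

  non-prime-extension⇒uniform-or-clone : ∀ {X u} → Prime X → X u ≡ false → ¬ Prime (insert u X) →
         ¬ ¬ (Uniform X u ⊎ Σ Point λ x → (X x ≡ true) × Clone X x u)
  non-prime-extension⇒uniform-or-clone {X} {u} P Xu nP k = nP pr
    where
    sXY : X ⊆ insert u X
    sXY q e = insert-old {u} {X} {q} e
    pr : Prime (insert u X)
    pr M m m' p sub md Mm Mm' mm' Yp Mp with any? (λ q → (X q ≟B true) ×-dec (M q ≟B false))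
    ... | yes (p0 , Xp0 , Mp0) = caseMM (insert-elim {u} {X} (sub m Mm)) (insert-elim {u} {X} (sub m' Mm'))
      where
      at-most-one : ∀ a b → M a ≡ true → X a ≡ true → M b ≡ true → X b ≡ true → a ≡ b
      at-most-one = module-meets-prime-once {X} {insert u X} {M} P sXY md Xp0 Mp0
      clp : ∀ x → X x ≡ true → M x ≡ true → M u ≡ true → Clone X x u
      clp x Xx Mx Mu z Xz zx = bool-case (M z) (λ Mz → ⊥-elim (zx (at-most-one z x Mz Xz Mx Xx)))
                             (λ Mz → md z x u (sXY z Xz) Mz Mx Mu)
      caseMM : (X m ≡ true) ⊎ (m ≡ u) → (X m' ≡ true) ⊎ (m' ≡ u) → ⊥
      caseMM (inj₁ a) (inj₁ b) = mm' (at-most-one m m' Mm a Mm' b)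
      caseMM (inj₂ refl) (inj₂ refl) = mm' refl
      caseMM (inj₁ a) (inj₂ refl) = k (inj₂ (m , a , clp m a Mm Mm'))
      caseMM (inj₂ refl) (inj₁ b) = k (inj₂ (m' , b , clp m' b Mm' Mm))
    ... | no ne = k (inj₁ uni)
      where
      allM : ∀ q → X q ≡ true → M q ≡ true
      allM q Xq = bool-case (M q) (λ e → e) (λ e → ⊥-elim (ne (q , Xq , e)))
      pu : p ≡ u
      pu with insert-elim {u} {X} Yp
      ... | inj₁ Xp = ⊥-elim (true≢false (allM p Xp) Mp)
      ... | inj₂ e = e
      uni : Uniform X u
      uni m1 m2 X1 X2 = md u m1 m2 (insert-new u X) (subst (λ r → M r ≡ false) pu Mp) (allM m1 X1) (allM m2 X2)

  -- Extending a prime set by one or two points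

  clone-unique : ∀ {X a b w} → Prime X → ThreePoints X → X a ≡ true → X b ≡ true →
                 Clone X a w → Clone X b w → a ≡ b
  clone-unique P T Xa Xb a-clone b-clone = case-≟ _ _ (λ a≡b → a≡b) λ a≢b →
    ⊥-elim (no-pair-module P T Xa Xb a≢b λ z Xz z≢a z≢b → trans (a-clone z Xz z≢a) (sym (b-clone z Xz z≢b)))

  insert₂-elim : ∀ {X u v q} → insert v (insert u X) q ≡ true → (X q ≡ true) ⊎ ((q ≡ u) ⊎ (q ≡ v))
  insert₂-elim {X} {u} {v} {q} e with insert-elim {v} {insert u X} e
  ... | inj₂ b = inj₂ (inj₂ b)
  ... | inj₁ a with insert-elim {u} {X} a
  ... | inj₁ c = inj₁ c
  ... | inj₂ d = inj₂ (inj₁ d)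

  module TwoPointExtension {X : Subset} {x u v : Point} (P : Prime X) (T : ThreePoints X)
    (Xx : X x ≡ true) (Xu : X u ≡ false) (Xv : X v ≡ false) (u≢v : u ≢ v)
    (u-clone : Clone X x u) (v-separates : rel v x ≢ rel v u)
    (v-kind : Uniform X v ⊎ Σ Point λ y → (X y ≡ true) × (y ≢ x) × Clone X y v) where

    Y : Subset
    Y = insert v (insert u X)

    X⊆Y : X ⊆ Y
    X⊆Y q e = insert-old {v} {insert u X} {q} (insert-old {u} {X} {q} e)

    ≢u : ∀ {z} → X z ≡ true → z ≢ u
    ≢u Xz refl = true≢false Xz Xu

    ≢v : ∀ {z} → X z ≡ true → z ≢ v
    ≢v Xz refl = true≢false Xz Xv

    v-clone⇒≢x : ∀ {x'} → X x' ≡ true → Clone X x' v → x' ≢ x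
    v-clone⇒≢x {x'} Xx' x'-clone x'≡x =
      [ no-uniform-clone P T Xx' Xv x'-clone
      , (λ (y , Xy , y≢x , y-clone) → y≢x (trans (sym (clone-unique P T Xx' Xy x'-clone y-clone)) x'≡x)) ] v-kind

    module _ {M : Subset} (M-module : IsModule Y M) where

      outside-uniform : ∀ {w} → Y w ≡ true → M w ≡ false → (∀ q → X q ≡ true → M q ≡ true) → Uniform X w
      outside-uniform Yw Mw X⊆M a b Xa Xb = M-module _ a b Yw Mw (X⊆M a Xa) (X⊆M b Xb)

      X⊆M-impossible : ∀ {p} → (∀ q → X q ≡ true → M q ≡ true) → Y p ≡ true → M p ≡ false → ⊥
      X⊆M-impossible {p} X⊆M Yp Mp with M u in Mu
      ... | false = no-uniform-clone P T Xx Xu u-clone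
                      (outside-uniform (insert-old {v} {insert u X} {u} (insert-new u X)) Mu X⊆M)
      ... | true with insert₂-elim {X} {u} {v} Yp
      ... | inj₁ Xp = true≢false (X⊆M p Xp) Mp
      ... | inj₂ (inj₁ refl) = true≢false Mu Mp
      ... | inj₂ (inj₂ refl) = v-separates (M-module v x u (insert-new v (insert u X)) Mp (X⊆M x Xx) Mu)

      module _ {p₀ : Point} (Xp₀ : X p₀ ≡ true) (Mp₀ : M p₀ ≡ false) where

        unique-in-X : ∀ a b → M a ≡ true → X a ≡ true → M b ≡ true → X b ≡ true → a ≡ b
        unique-in-X = module-meets-prime-once P X⊆Y M-module Xp₀ Mp₀

        member-clone : ∀ {w x'} → M w ≡ true → M x' ≡ true → X x' ≡ true → Clone X x' w
        member-clone Mw Mx' Xx' z Xz z≢x' with M z in Mz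
        ... | true = ⊥-elim (z≢x' (unique-in-X z _ Mz Xz Mx' Xx'))
        ... | false = M-module z _ _ (X⊆Y z Xz) Mz Mx' Mw

        u-member⇒x-member : ∀ {x'} → M u ≡ true → M x' ≡ true → X x' ≡ true → x' ≡ x
        u-member⇒x-member Mu Mx' Xx' = clone-unique P T Xx' Xx (member-clone Mu Mx' Xx') u-clone

        new-pair-module : M u ≡ true → M v ≡ true → (∀ z → X z ≡ true → M z ≡ false) → ⊥
        new-pair-module Mu Mv X∩M=∅ = v-clone⇒≢x Xx x-clone refl
          where
          x-clone : Clone X x v
          x-clone z Xz z≢x = trans (u-clone z Xz z≢x) (M-module z u v (X⊆Y z Xz) (X∩M=∅ z Xz) Mu Mv)

        new-pair-with-old : ∀ {x'} → M u ≡ true → M v ≡ true → M x' ≡ true → X x' ≡ true → ⊥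
        new-pair-with-old Mu Mv Mx' Xx' with u-member⇒x-member Mu Mx' Xx'
        ... | refl = v-clone⇒≢x Xx (member-clone Mv Mx' Xx') refl

        u-with-old : ∀ {x'} → M u ≡ true → M v ≡ false → M x' ≡ true → X x' ≡ true → ⊥
        u-with-old Mu Mv Mx' Xx' with u-member⇒x-member Mu Mx' Xx'
        ... | refl = v-separates (M-module v x u (insert-new v (insert u X)) Mv Mx' Mu)

        -- v sees x as x' does (v is a clone of x'), and x' sees x as u does.
        v-with-old : ∀ {x'} → M u ≡ false → M v ≡ true → M x' ≡ true → X x' ≡ true → ⊥
        v-with-old {x'} Mu Mv Mx' Xx' = v-separates (begin
          rel v x              ≡⟨ sym (rel-flip x≢x' (≢v Xx) (x'-clone x Xx x≢x')) ⟩
          rel x' x             ≡⟨ u-clone x' Xx' x'≢x ⟩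
          rel x' u             ≡⟨ rel-swap (λ e → ≢u Xx' (sym e)) ⟩
          opposite (rel u x')  ≡⟨ cong opposite u-sees-x'-as-v ⟩
          opposite (rel u v)   ≡⟨ sym (rel-swap u≢v) ⟩
          rel v u              ∎)
          where
          open ≡-Reasoning
          x'-clone : Clone X x' v
          x'-clone = member-clone Mv Mx' Xx'
          x'≢x : x' ≢ x
          x'≢x = v-clone⇒≢x Xx' x'-clone
          x≢x' : x ≢ x'
          x≢x' e = x'≢x (sym e)
          u-sees-x'-as-v : rel u x' ≡ rel u v
          u-sees-x'-as-v = M-module u x' v (insert-old {v} {insert u X} {u} (insert-new u X)) Mu Mx' Mv

    prime : Prime Y
    prime M m₁ m₂ p M⊆Y M-module Mm₁ Mm₂ m₁≢m₂ Yp Mp with any? (λ q → (X q ≟B true) ×-dec (M q ≟B false))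
    ... | no X⊆M = X⊆M-impossible M-module (λ q Xq → bool-case (M q) (λ e → e) (λ e → ⊥-elim (X⊆M (q , Xq , e)))) Yp Mp
    ... | yes (p₀ , Xp₀ , Mp₀) with M u in Mu | M v in Mv | any? (λ q → (X q ≟B true) ×-dec (M q ≟B true))
    ... | true  | true  | yes (x' , Xx' , Mx') = new-pair-with-old M-module Xp₀ Mp₀ Mu Mv Mx' Xx'
    ... | true  | false | yes (x' , Xx' , Mx') = u-with-old M-module Xp₀ Mp₀ Mu Mv Mx' Xx'
    ... | false | true  | yes (x' , Xx' , Mx') = v-with-old M-module Xp₀ Mp₀ Mu Mv Mx' Xx'
    ... | true  | true  | no X∩M=∅ = new-pair-module M-module Xp₀ Mp₀ Mu Mv
                                       (λ z Xz → bool-case (M z) (λ e → ⊥-elim (X∩M=∅ (z , Xz , e))) (λ e → e))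
    ... | false | false | _ with insert₂-elim {X} {u} {v} (M⊆Y m₁ Mm₁) | insert₂-elim {X} {u} {v} (M⊆Y m₂ Mm₂)
    ...   | inj₁ X₁ | inj₁ X₂ = m₁≢m₂ (unique-in-X M-module Xp₀ Mp₀ m₁ m₂ Mm₁ X₁ Mm₂ X₂)
    ...   | inj₂ (inj₁ refl) | _ = true≢false Mm₁ Mu
    ...   | inj₂ (inj₂ refl) | _ = true≢false Mm₁ Mv
    ...   | _ | inj₂ (inj₁ refl) = true≢false Mm₂ Mu
    ...   | _ | inj₂ (inj₂ refl) = true≢false Mm₂ Mv
    prime M m₁ m₂ p M⊆Y M-module Mm₁ Mm₂ m₁≢m₂ Yp Mp | yes _ | true | false | no X∩M=∅
      with insert₂-elim {X} {u} {v} (M⊆Y m₁ Mm₁) | insert₂-elim {X} {u} {v} (M⊆Y m₂ Mm₂)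
    ...   | inj₂ (inj₁ refl) | inj₂ (inj₁ refl) = m₁≢m₂ refl
    ...   | inj₁ X₁ | _ = X∩M=∅ (m₁ , X₁ , Mm₁)
    ...   | _ | inj₁ X₂ = X∩M=∅ (m₂ , X₂ , Mm₂)
    ...   | inj₂ (inj₂ refl) | _ = true≢false Mm₁ Mv
    ...   | _ | inj₂ (inj₂ refl) = true≢false Mm₂ Mv
    prime M m₁ m₂ p M⊆Y M-module Mm₁ Mm₂ m₁≢m₂ Yp Mp | yes _ | false | true | no X∩M=∅
      with insert₂-elim {X} {u} {v} (M⊆Y m₁ Mm₁) | insert₂-elim {X} {u} {v} (M⊆Y m₂ Mm₂)
    ...   | inj₂ (inj₂ refl) | inj₂ (inj₂ refl) = m₁≢m₂ refl
    ...   | inj₁ X₁ | _ = X∩M=∅ (m₁ , X₁ , Mm₁)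
    ...   | _ | inj₁ X₂ = X∩M=∅ (m₂ , X₂ , Mm₂)
    ...   | inj₂ (inj₁ refl) | _ = true≢false Mm₁ Mu
    ...   | _ | inj₂ (inj₁ refl) = true≢false Mm₂ Mu

  rel-≟ : ∀ (a b : Bool × Bool) → Dec (a ≡ b)
  rel-≟ = ≡-dec _≟B_ _≟B_

  Clone? : ∀ X x u → Dec (Clone X x u)
  Clone? X x u = all? (λ z → (X z ≟B true) →-dec
                     ((¬? (z ≟ x)) →-dec rel-≟ (rel z x) (rel z u)))

  PrimeExtension : Subset → Set
  PrimeExtension X = Σ Subset λ Y → Σ Point λ u → Σ Point λ v → Prime Y × X ⊆ Y × (Y u ≡ true) × (X u ≡ false) ×
                       (∀ q → Y q ≡ true → X q ≡ false → (q ≡ u) ⊎ (q ≡ v))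

  module _ {X : Subset} (V-prime : Prime full) (P : Prime X) (T : ThreePoints X) where

    one-point-extension : ∀ {u} → X u ≡ false → Prime (insert u X) → PrimeExtension X
    one-point-extension {u} Xu Pu = insert u X , u , u , Pu , (λ q → insert-old {u} {X} {q}) , insert-new u X , Xu , new
      where
      new : ∀ q → insert u X q ≡ true → X q ≡ false → (q ≡ u) ⊎ (q ≡ u)
      new q Yq Xq with insert-elim {u} {X} Yq
      ... | inj₁ Xq' = ⊥-elim (true≢false Xq' Xq)
      ... | inj₂ q≡u = inj₁ q≡u

    two-point-extension : ∀ {x u v} → X x ≡ true → X u ≡ false → X v ≡ false → u ≢ v →
      Clone X x u → rel v x ≢ rel v u → (Uniform X v ⊎ Σ Point λ y → (X y ≡ true) × (y ≢ x) × Clone X y v) →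
      PrimeExtension X
    two-point-extension {x} {u} {v} Xx Xu Xv u≢v u-clone v-separates v-kind =
      insert v (insert u X) , u , v , TwoPointExtension.prime P T Xx Xu Xv u≢v u-clone v-separates v-kind ,
      (λ q e → insert-old {v} {insert u X} {q} (insert-old {u} {X} {q} e)) ,
      insert-old {v} {insert u X} {u} (insert-new u X) , Xu , new
      where
      new : ∀ q → insert v (insert u X) q ≡ true → X q ≡ false → (q ≡ u) ⊎ (q ≡ v)
      new q Yq Xq with insert₂-elim {X} {u} {v} Yq
      ... | inj₁ Xq' = ⊥-elim (true≢false Xq' Xq)
      ... | inj₂ q∈uv = q∈uv

    NoOnePointExtension : Set
    NoOnePointExtension = ∀ u → X u ≡ false → ¬ Prime (insert u X)

    -- Without clones every outside point is uniform on X, so X would be a module of the whole set.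
    no-clone-impossible : ∀ {w} → X w ≡ false → NoOnePointExtension →
      ¬ (Σ Point λ x → Σ Point λ u → (X x ≡ true) × (X u ≡ false) × Clone X x u) → ⊥
    no-clone-impossible {w} Xw no-ext no-clone = V-prime X a b w (λ _ _ → refl) X-module Xa Xb ab refl Xw
      where
      open ThreePoints T
      X-module : IsModule full X
      X-module z m m' _ Xz Xm Xm' = decidable-stable (rel-≟ (rel z m) (rel z m')) λ ≢ →
        non-prime-extension⇒uniform-or-clone P Xz (no-ext z Xz)
          [ (λ z-uniform → ≢ (z-uniform m m' Xm Xm')) , (λ (x , Xx , x-clone) → no-clone (x , z , Xx , Xz , x-clone)) ]

    -- The set of x and its outside clones is not a module of the whole set; a point separating
    -- two of its members separates x from one of its clones.
    clone-separated : ∀ {x u₀} → X x ≡ true → X u₀ ≡ false → Clone X x u₀ →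
      ¬ ¬ (Σ Point λ z → Σ Point λ u → (X z ≡ false) × ¬ Clone X x z × (X u ≡ false) × Clone X x u × (rel z x ≢ rel z u))
    clone-separated {x} {u₀} Xx Xu₀ u₀-clone ¬sep =
      ¬¬-excluded-middle {A = Σ Point λ z → Σ Point λ m → Σ Point λ m' →
                                (W z ≡ false) × (W m ≡ true) × (W m' ≡ true) × (rel z m ≢ rel z m')} separation
      where
      W : Subset
      W q = eqb q x ∨ (not (X q) ∧ does (Clone? X x q))
      Wx : W x ≡ true
      Wx = ∨-trueˡ (eqb-refl x)
      W-clone : ∀ {q} → X q ≡ false → Clone X x q → W q ≡ true
      W-clone {q} Xq c = ∨-trueʳ {eqb q x} (∧-true (not-false Xq) (⇒does-true (Clone? X x q) c))
      W-elim : ∀ {q} → W q ≡ true → (q ≡ x) ⊎ ((X q ≡ false) × Clone X x q)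
      W-elim {q} e with ∨-true-elim {eqb q x} e
      ... | inj₁ a = inj₁ (eqb-true a)
      ... | inj₂ b = inj₂ (not-true-elim (proj₁ (∧-true-elim b)) , does-true⇒ (Clone? X x q) (proj₂ (∧-true-elim {not (X q)} b)))
      separated-clone : ∀ {z m m'} → W m ≡ true → W m' ≡ true → rel z m ≢ rel z m' →
                        Σ Point λ u → (X u ≡ false) × Clone X x u × (rel z x ≢ rel z u)
      separated-clone {z} {m} {m'} Wm Wm' ≢ with W-elim Wm | W-elim Wm'
      ... | inj₁ refl | inj₁ refl = ⊥-elim (≢ refl)
      ... | inj₁ refl | inj₂ (Xm' , m'-clone) = m' , Xm' , m'-clone , ≢
      ... | inj₂ (Xm , m-clone) | inj₁ refl = m , Xm , m-clone , (λ e → ≢ (sym e))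
      ... | inj₂ (Xm , m-clone) | inj₂ (Xm' , m'-clone) with rel-≟ (rel z x) (rel z m)
      ...   | yes eq = m' , Xm' , m'-clone , (λ e → ≢ (trans (sym eq) e))
      ...   | no neq = m , Xm , m-clone , neq
      separation : Dec (Σ Point λ z → Σ Point λ m → Σ Point λ m' →
                          (W z ≡ false) × (W m ≡ true) × (W m' ≡ true) × (rel z m ≢ rel z m')) → ⊥
      separation (no none) with two-others T x
      ... | y , _ , Xy , _ , y≢x , _ , _ =
        V-prime W x u₀ y (λ _ _ → refl) W-module Wx (W-clone Xu₀ u₀-clone)
          (λ e → true≢false Xx (subst (λ r → X r ≡ false) (sym e) Xu₀)) refl Wy
        where
        W-module : IsModule full W
        W-module z m m' _ Wz Wm Wm' = decidable-stable (rel-≟ (rel z m) (rel z m')) λ ≢ → none (z , m , m' , Wz , Wm , Wm' , ≢)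
        Wy : W y ≡ false
        Wy with W y in e
        ... | false = refl
        ... | true with W-elim e
        ...   | inj₁ y≡x = ⊥-elim (y≢x y≡x)
        ...   | inj₂ (Xy' , _) = ⊥-elim (true≢false Xy Xy')
      separation (yes (z , m , m' , Wz , Wm , Wm' , ≢)) with separated-clone Wm Wm' ≢
      ... | u , Xu , u-clone , z-separates = bool-case (X z)
        (λ Xz → z-separates (u-clone z Xz λ z≡x → true≢false (subst (λ r → W r ≡ true) (sym z≡x) Wx) Wz))
        (λ Xz → ¬sep (z , u , Xz , (λ z-clone → true≢false (W-clone Xz z-clone) Wz) , Xu , u-clone , z-separates))

  extension-step : ∀ {X w} → Prime full → Prime X → ThreePoints X → X w ≡ false → ¬ ¬ PrimeExtension X
  extension-step {X} {w} V-prime P T Xw ¬ext = ¬¬-excluded-middle {A = ∃ λ u → (X u ≡ false) × Prime (insert u X)} λ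
    { (yes (u , Xu , Pu)) → ¬ext (one-point-extension V-prime P T Xu Pu)
    ; (no none) → let no-ext u Xu Pu = none (u , Xu , Pu) in
        ¬¬-excluded-middle {A = Σ Point λ x → Σ Point λ u → (X x ≡ true) × (X u ≡ false) × Clone X x u} λ
        { (no no-clone) → no-clone-impossible V-prime P T Xw no-ext no-clone
        ; (yes (x , u₀ , Xx , Xu₀ , u₀-clone)) → clone-separated V-prime P T Xx Xu₀ u₀-clone
            λ (z , u , Xz , z-not-clone , Xu , u-clone , z-separates) →
              non-prime-extension⇒uniform-or-clone P Xz (no-ext z Xz)
                [ (λ z-uniform → ¬ext (two-point-extension V-prime P T Xx Xu Xz (u≢z z-not-clone u-clone) u-clone z-separates
                                        (inj₁ z-uniform)))
                , (λ (y , Xy , y-clone) → case-≟ y x (λ { refl → z-not-clone y-clone }) λ y≢x →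
                     ¬ext (two-point-extension V-prime P T Xx Xu Xz (u≢z z-not-clone u-clone) u-clone z-separates
                            (inj₂ (y , Xy , y≢x , y-clone)))) ] } }
    where
    u≢z : ∀ {x u z} → ¬ Clone X x z → Clone X x u → u ≢ z
    u≢z z-not-clone u-clone refl = z-not-clone u-clone

  compl : Subset → Subset
  compl X q = not (X q)

  compl-shrinks : ∀ {X Y u} → X ⊆ Y → Y u ≡ true → X u ≡ false → count (compl Y) < count (compl X)
  compl-shrinks {X} {Y} {u} X⊆Y Yu Xu = count-strict (compl Y) (compl X) ∉Y⇒∉X u (not-true Yu) (not-false Xu)
    where
    ∉Y⇒∉X : ∀ q → compl Y q ≡ true → compl X q ≡ true
    ∉Y⇒∉X q ∉Y with X q in Xq
    ... | true = ⊥-elim (true≢false (X⊆Y q Xq) (not-true-elim ∉Y))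
    ... | false = refl

  ThreeOutside : Subset → Set
  ThreeOutside X = Σ Point λ a → Σ Point λ b → Σ Point λ c →
                     (X a ≡ false) × (X b ≡ false) × (X c ≡ false) × (a ≢ b) × (a ≢ c) × (b ≢ c)

  outside-after-extension : ∀ {X Y : Subset} {u v : Point} → (∀ q → Y q ≡ true → X q ≡ false → (q ≡ u) ⊎ (q ≡ v)) →
                            ThreeOutside X → ∃ λ w → Y w ≡ false
  outside-after-extension {X} {Y} {u} {v} new (a , b , c , Xa , Xb , Xc , a≢b , a≢c , b≢c)
    = bool-case (Y a) (λ Ya → bool-case (Y b) (λ Yb → bool-case (Y c)
        (λ Yc → pigeon (new a Ya Xa) (new b Yb Xb) (new c Yc Xc)) (c ,_)) (b ,_)) (a ,_)
    where
    pigeon : (a ≡ u) ⊎ (a ≡ v) → (b ≡ u) ⊎ (b ≡ v) → (c ≡ u) ⊎ (c ≡ v) → ∃ λ w → Y w ≡ false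
    pigeon (inj₁ refl) (inj₁ refl) _ = ⊥-elim (a≢b refl)
    pigeon (inj₂ refl) (inj₂ refl) _ = ⊥-elim (a≢b refl)
    pigeon (inj₁ refl) _ (inj₁ refl) = ⊥-elim (a≢c refl)
    pigeon (inj₂ refl) _ (inj₂ refl) = ⊥-elim (a≢c refl)
    pigeon _ (inj₁ refl) (inj₁ refl) = ⊥-elim (b≢c refl)
    pigeon _ (inj₂ refl) (inj₂ refl) = ⊥-elim (b≢c refl)

  grow : ∀ f {X} → count (compl X) ≤ f → Prime full → Prime X → ThreePoints X → (∃ λ w → X w ≡ false) →
         ¬ ¬ (Σ Subset λ Y → Prime Y × (∃ λ w → Y w ≡ false) × ¬ ThreeOutside Y)
  grow zero {X} few _ _ _ (w , Xw) _ =
    ℕP.n≮0 (ℕP.<-≤-trans (count-strict (λ _ → false) (compl X) (λ _ ()) w refl (not-false Xw)) few)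
  grow (suc f) {X} few V-prime P T out ¬Y = ¬¬-excluded-middle {A = ThreeOutside X} λ
    { (no ¬three) → ¬Y (X , P , out , ¬three)
    ; (yes outside@(a , _ , _ , Xa , _)) → extension-step V-prime P T Xa λ (Y , u , v , PY , X⊆Y , Yu , Xu , new) →
        grow f (ℕP.≤-pred (ℕP.<-≤-trans (compl-shrinks X⊆Y Yu Xu) few)) V-prime PY (ThreePoints-mono X⊆Y T)
          (outside-after-extension {X} {Y} new outside) ¬Y }

  -- Four-point prime sets and sum/skew decompositions

  four : Point → Point → Point → Point → Subset
  four p1 p2 p3 p4 q = eqb q p1 ∨ (eqb q p2 ∨ (eqb q p3 ∨ eqb q p4))

  four-elim : ∀ {p1 p2 p3 p4 q} → four p1 p2 p3 p4 q ≡ true → (q ≡ p1) ⊎ ((q ≡ p2) ⊎ ((q ≡ p3) ⊎ (q ≡ p4)))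
  four-elim {p1} {p2} {p3} {p4} {q} e with ∨-true-elim {eqb q p1} e
  ... | inj₁ a = inj₁ (eqb-true a)
  ... | inj₂ b with ∨-true-elim {eqb q p2} b
  ... | inj₁ c = inj₂ (inj₁ (eqb-true c))
  ... | inj₂ d with ∨-true-elim {eqb q p3} d
  ... | inj₁ f = inj₂ (inj₂ (inj₁ (eqb-true f)))
  ... | inj₂ g = inj₂ (inj₂ (inj₂ (eqb-true g)))

  four-∋₁ : ∀ p1 p2 p3 p4 → four p1 p2 p3 p4 p1 ≡ true
  four-∋₁ p1 p2 p3 p4 = ∨-trueˡ (eqb-refl p1)
  four-∋₂ : ∀ p1 p2 p3 p4 → four p1 p2 p3 p4 p2 ≡ true
  four-∋₂ p1 p2 p3 p4 = ∨-trueʳ {eqb p2 p1} (∨-trueˡ (eqb-refl p2))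
  four-∋₃ : ∀ p1 p2 p3 p4 → four p1 p2 p3 p4 p3 ≡ true
  four-∋₃ p1 p2 p3 p4 = ∨-trueʳ {eqb p3 p1} (∨-trueʳ {eqb p3 p2} (∨-trueˡ (eqb-refl p3)))
  four-∋₄ : ∀ p1 p2 p3 p4 → four p1 p2 p3 p4 p4 ≡ true
  four-∋₄ p1 p2 p3 p4 = ∨-trueʳ {eqb p4 p1} (∨-trueʳ {eqb p4 p2} (∨-trueʳ {eqb p4 p3} (eqb-refl p4)))

  prime-3142 : ∀ {p1 p2 p3 p4} → before p1 p2 ≡ true → before p2 p3 ≡ true → before p3 p4 ≡ true →
           below p2 p4 ≡ true → below p4 p1 ≡ true → below p1 p3 ≡ true → Prime (four p1 p2 p3 p4)
  prime-3142 {p1} {p2} {p3} {p4} a12 a23 a34 b24 b41 b13 M m1 m2 p sub md M1 M2 m12 Xp Mp =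
    by-membership (M p1) (M p2) (M p3) (M p4) refl refl refl refl
    where
    X : Subset
    X = four p1 p2 p3 p4
    X1 = four-∋₁ p1 p2 p3 p4
    X2 = four-∋₂ p1 p2 p3 p4
    X3 = four-∋₃ p1 p2 p3 p4
    X4 = four-∋₄ p1 p2 p3 p4
    a24 = StrictTotalᵇ.transitive before-order p2 p3 p4 a23 a34
    pos-p3≮p1 = true⇒swap-false before-order {p1} {p3} (StrictTotalᵇ.transitive before-order p1 p2 p3 a12 a23)
    val-p4≮p2 = true⇒swap-false below-order {p2} {p4} b24
    pos-p2≮p1 = true⇒swap-false before-order {p1} {p2} a12
    val-p1≮p2 = true⇒swap-false below-order {p2} {p1} (StrictTotalᵇ.transitive below-order p2 p4 p1 b24 b41)
    pos-p3≮p2 = true⇒swap-false before-order {p2} {p3} a23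
    val-p1≮p4 = true⇒swap-false below-order {p4} {p1} b41
    separated-by-position : ∀ z m m' → X z ≡ true → M z ≡ false → M m ≡ true → M m' ≡ true →
                            before z m ≡ true → before z m' ≡ false → ⊥
    separated-by-position z m m' Xz Mz Mm Mm' t f = true≢false (trans (sym (cong proj₁ (md z m m' Xz Mz Mm Mm'))) t) f
    separated-by-value : ∀ z m m' → X z ≡ true → M z ≡ false → M m ≡ true → M m' ≡ true → below z m ≡ true → below z m' ≡ false → ⊥
    separated-by-value z m m' Xz Mz Mm Mm' t f = true≢false (trans (sym (cong proj₂ (md z m m' Xz Mz Mm Mm'))) t) f
    member : ∀ q → M q ≡ true → ((q ≡ p1) × (M p1 ≡ true)) ⊎ (((q ≡ p2) × (M p2 ≡ true)) ⊎
             (((q ≡ p3) × (M p3 ≡ true)) ⊎ ((q ≡ p4) × (M p4 ≡ true))))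
    member q Mq with four-elim {p1} {p2} {p3} {p4} {q} (sub q Mq)
    ... | inj₁ refl = inj₁ (refl , Mq)
    ... | inj₂ (inj₁ refl) = inj₂ (inj₁ (refl , Mq))
    ... | inj₂ (inj₂ (inj₁ refl)) = inj₂ (inj₂ (inj₁ (refl , Mq)))
    ... | inj₂ (inj₂ (inj₂ refl)) = inj₂ (inj₂ (inj₂ (refl , Mq)))
    only-p1 : M p2 ≡ false → M p3 ≡ false → M p4 ≡ false → ∀ q → M q ≡ true → q ≡ p1
    only-p1 e2 e3 e4 q Mq with member q Mq
    ... | inj₁ (r , _) = r
    ... | inj₂ (inj₁ (_ , t)) = ⊥-elim (true≢false t e2)
    ... | inj₂ (inj₂ (inj₁ (_ , t))) = ⊥-elim (true≢false t e3)
    ... | inj₂ (inj₂ (inj₂ (_ , t))) = ⊥-elim (true≢false t e4)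
    only-p2 : M p1 ≡ false → M p3 ≡ false → M p4 ≡ false → ∀ q → M q ≡ true → q ≡ p2
    only-p2 e1 e3 e4 q Mq with member q Mq
    ... | inj₁ (_ , t) = ⊥-elim (true≢false t e1)
    ... | inj₂ (inj₁ (r , _)) = r
    ... | inj₂ (inj₂ (inj₁ (_ , t))) = ⊥-elim (true≢false t e3)
    ... | inj₂ (inj₂ (inj₂ (_ , t))) = ⊥-elim (true≢false t e4)
    only-p3 : M p1 ≡ false → M p2 ≡ false → M p4 ≡ false → ∀ q → M q ≡ true → q ≡ p3
    only-p3 e1 e2 e4 q Mq with member q Mq
    ... | inj₁ (_ , t) = ⊥-elim (true≢false t e1)
    ... | inj₂ (inj₁ (_ , t)) = ⊥-elim (true≢false t e2)
    ... | inj₂ (inj₂ (inj₁ (r , _))) = r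
    ... | inj₂ (inj₂ (inj₂ (_ , t))) = ⊥-elim (true≢false t e4)
    only-p4 : M p1 ≡ false → M p2 ≡ false → M p3 ≡ false → ∀ q → M q ≡ true → q ≡ p4
    only-p4 e1 e2 e3 q Mq with member q Mq
    ... | inj₁ (_ , t) = ⊥-elim (true≢false t e1)
    ... | inj₂ (inj₁ (_ , t)) = ⊥-elim (true≢false t e2)
    ... | inj₂ (inj₂ (inj₁ (_ , t))) = ⊥-elim (true≢false t e3)
    ... | inj₂ (inj₂ (inj₂ (r , _))) = r
    empty : M p1 ≡ false → M p2 ≡ false → M p3 ≡ false → M p4 ≡ false → ⊥
    empty e1 e2 e3 e4 with member m1 M1
    ... | inj₁ (_ , t) = true≢false t e1
    ... | inj₂ (inj₁ (_ , t)) = true≢false t e2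
    ... | inj₂ (inj₂ (inj₁ (_ , t))) = true≢false t e3
    ... | inj₂ (inj₂ (inj₂ (_ , t))) = true≢false t e4
    everything : M p1 ≡ true → M p2 ≡ true → M p3 ≡ true → M p4 ≡ true → ⊥
    everything e1 e2 e3 e4 with four-elim {p1} {p2} {p3} {p4} {p} Xp
    ... | inj₁ refl = true≢false e1 Mp
    ... | inj₂ (inj₁ refl) = true≢false e2 Mp
    ... | inj₂ (inj₂ (inj₁ refl)) = true≢false e3 Mp
    ... | inj₂ (inj₂ (inj₂ refl)) = true≢false e4 Mp
    -- In each case a point outside M either sees two members of M differently or M is a singleton.
    by-membership : ∀ b1 b2 b3 b4 → M p1 ≡ b1 → M p2 ≡ b2 → M p3 ≡ b3 → M p4 ≡ b4 → ⊥
    by-membership true true true true e1 e2 e3 e4 = everything e1 e2 e3 e4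
    by-membership true true true false e1 e2 e3 e4 = separated-by-value p4 p1 p2 (X4) e4 e1 e2 b41 val-p4≮p2
    by-membership true true false true e1 e2 e3 e4 = separated-by-position p3 p4 p1 (X3) e3 e4 e1 a34 pos-p3≮p1
    by-membership true true false false e1 e2 e3 e4 = separated-by-value p4 p1 p2 (X4) e4 e1 e2 b41 val-p4≮p2
    by-membership true false true true e1 e2 e3 e4 = separated-by-position p2 p3 p1 (X2) e2 e3 e1 a23 pos-p2≮p1
    by-membership true false true false e1 e2 e3 e4 = separated-by-position p2 p3 p1 (X2) e2 e3 e1 a23 pos-p2≮p1
    by-membership true false false true e1 e2 e3 e4 = separated-by-position p2 p4 p1 (X2) e2 e4 e1 a24 pos-p2≮p1
    by-membership true false false false e1 e2 e3 e4 = m12 (trans (only-p1 e2 e3 e4 m1 M1) (sym (only-p1 e2 e3 e4 m2 M2)))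
    by-membership false true true true e1 e2 e3 e4 = separated-by-value p1 p3 p2 (X1) e1 e3 e2 b13 val-p1≮p2
    by-membership false true true false e1 e2 e3 e4 = separated-by-value p1 p3 p2 (X1) e1 e3 e2 b13 val-p1≮p2
    by-membership false true false true e1 e2 e3 e4 = separated-by-position p3 p4 p2 (X3) e3 e4 e2 a34 pos-p3≮p2
    by-membership false true false false e1 e2 e3 e4 = m12 (trans (only-p2 e1 e3 e4 m1 M1) (sym (only-p2 e1 e3 e4 m2 M2)))
    by-membership false false true true e1 e2 e3 e4 = separated-by-value p1 p3 p4 (X1) e1 e3 e4 b13 val-p1≮p4
    by-membership false false true false e1 e2 e3 e4 = m12 (trans (only-p3 e1 e2 e4 m1 M1) (sym (only-p3 e1 e2 e4 m2 M2)))
    by-membership false false false true e1 e2 e3 e4 = m12 (trans (only-p4 e1 e2 e3 m1 M1) (sym (only-p4 e1 e2 e3 m2 M2)))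
    by-membership false false false false e1 e2 e3 e4 = empty e1 e2 e3 e4

  delete : Point → Subset → Subset
  delete x X q = X q ∧ not (eqb q x)

  delete-⊆ : ∀ {x X q} → delete x X q ≡ true → X q ≡ true
  delete-⊆ e = proj₁ (∧-true-elim e)
  delete-≢ : ∀ {x X q} → delete x X q ≡ true → q ≢ x
  delete-≢ {x} {X} {q} e refl = true≢false (proj₂ (∧-true-elim {X q} e)) (not-true (eqb-refl q))
  delete-intro : ∀ {x X q} → X q ≡ true → q ≢ x → delete x X q ≡ true
  delete-intro Xq ne = ∧-true Xq (not-false (eqb-false ne))

  SumBlock : Subset → Subset → Set
  SumBlock X A = ∀ a b → A a ≡ true → X b ≡ true → A b ≡ false → (before a b ≡ true) × (below a b ≡ true)
  SkewBlock : Subset → Subset → Set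
  SkewBlock X A = ∀ a b → A a ≡ true → X b ≡ true → A b ≡ false → (before a b ≡ true) × (below b a ≡ true)

  Decomposable : Subset → Set
  Decomposable X = Σ Subset λ A → A ⊆ X × (∃ λ a → A a ≡ true) × (∃ λ b → (X b ≡ true) × (A b ≡ false)) ×
             (SumBlock X A ⊎ SkewBlock X A)

  NoPrime3142 : Set
  NoPrime3142 = ∀ p1 p2 p3 p4 → before p1 p2 ≡ true → before p2 p3 ≡ true → before p3 p4 ≡ true → Prime (four p1 p2 p3 p4) → ⊥

  -- Adding a last point x to a set whose other points split as a lower sum block A.
  module SumExtension (no-3142 : NoPrime3142) (X : Subset) (x : Point) (Xx : X x ≡ true)
    (x-last : ∀ y → X y ≡ true → y ≢ x → before y x ≡ true)
    (A : Subset) (A⊆X' : A ⊆ delete x X) (A-inhabited : ∃ λ a → A a ≡ true)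
    (outside-A : ∃ λ b → (delete x X b ≡ true) × (A b ≡ false)) (sum : SumBlock (delete x X) A) where

    X' : Subset
    X' = delete x X

    A⊆X : A ⊆ X
    A⊆X q e = delete-⊆ {x} {X} (A⊆X' q e)

    b₀ : Point
    b₀ = proj₁ outside-A

    X'b₀ : X' b₀ ≡ true
    X'b₀ = proj₁ (proj₂ outside-A)

    Ab₀ : A b₀ ≡ false
    Ab₀ = proj₂ (proj₂ outside-A)

    A-x : A x ≡ false
    A-x = bool-case (A x) (λ e → ⊥-elim (delete-≢ {x} {X} (A⊆X' x e) refl)) (λ e → e)

    A-sum : ¬ (∃ λ a → (A a ≡ true) × (below a x ≡ false)) → SumBlock X A
    A-sum x-above-A a b Aa Xb Ab = case-≟ b x
      (λ { refl → x-last a (A⊆X a Aa) (delete-≢ {x} {X} (A⊆X' a Aa)) ,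
                  bool-case (below a b) (λ e → e) (λ e → ⊥-elim (x-above-A (a , Aa , e))) })
      (λ b≢x → sum a b Aa (delete-intro {x} {X} Xb b≢x) Ab)

    X'-skew : ¬ (∃ λ c → (X' c ≡ true) × (below x c ≡ false)) → SkewBlock X X'
    X'-skew x-lowest a b X'a Xb X'b = case-≟ b x
      (λ { refl → x-last a (delete-⊆ {x} {X} X'a) (delete-≢ {x} {X} X'a) ,
                  bool-case (below x a) (λ e → e) (λ e → ⊥-elim (x-lowest (a , X'a , e))) })
      (λ b≢x → ⊥-elim (true≢false (delete-intro {x} {X} Xb b≢x) X'b))

    A-below-x : Subset
    A-below-x q = A q ∧ below q x

    Straddle : Set
    Straddle = ∃ λ h → (A h ≡ true) × ((below x h ≡ true) × (∃ λ l → (A l ≡ true) × ((below l x ≡ true) × (before h l ≡ true))))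

    -- h, l, a point outside A and x would form a prime 3142.
    no-straddle : ¬ Straddle
    no-straddle (h , Ah , x<h , l , Al , l<x , h<l) =
      no-3142 h l b₀ x h<l (proj₁ (sum l b₀ Al X'b₀ Ab₀)) b₀-before-x
              (prime-3142 h<l (proj₁ (sum l b₀ Al X'b₀ Ab₀)) b₀-before-x l<x x<h (proj₂ (sum h b₀ Ah X'b₀ Ab₀)))
      where
      b₀-before-x = x-last b₀ (delete-⊆ {x} {X} X'b₀) (delete-≢ {x} {X} X'b₀)

    A-below-x-sum : ¬ Straddle → SumBlock X A-below-x
    A-below-x-sum ¬straddle l y Ll Xy Ly = case-≟ y x
      (λ { refl → x-last l (A⊆X l Al) (delete-≢ {x} {X} (A⊆X' l Al)) , l<x })
      (λ y≢x → bool-case (A y) (λ Ay → in-A y≢x Ay) (λ Ay → sum l y Al (delete-intro {x} {X} Xy y≢x) Ay))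
      where
      Al = proj₁ (∧-true-elim {A l} Ll)
      l<x = proj₂ (∧-true-elim {A l} Ll)
      in-A : y ≢ x → A y ≡ true → (before l y ≡ true) × (below l y ≡ true)
      in-A y≢x Ay = l-before-y , StrictTotalᵇ.transitive below-order l x y l<x x<y
        where
        y≮x : below y x ≡ false
        y≮x = bool-case (below y x) (λ e → ⊥-elim (true≢false (∧-true Ay e) Ly)) (λ e → e)
        x<y : below x y ≡ true
        x<y = false⇒swap-true below-order y≢x y≮x
        l≢y : l ≢ y
        l≢y refl = true≢false l<x y≮x
        l-before-y : before l y ≡ true
        l-before-y = bool-case (before y l) (λ e → ⊥-elim (¬straddle (y , Ay , x<y , l , Al , l<x , e)))
                                            (λ e → false⇒swap-true before-order (λ e' → l≢y (sym e')) e)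

    decomposable : Decomposable X
    decomposable with any? (λ a → (A a ≟B true) ×-dec (below a x ≟B false))
    ... | no x-above-A = A , A⊆X , A-inhabited , (b₀ , delete-⊆ {x} {X} X'b₀ , Ab₀) , inj₁ (A-sum x-above-A)
    ... | yes (a₁ , Aa₁ , a₁≮x) with any? (λ c → (X' c ≟B true) ×-dec (below x c ≟B false))
    ...   | no x-lowest = X' , (λ q e → delete-⊆ {x} {X} e) , (b₀ , X'b₀) , (x , Xx , ∧-falseʳ {X x} (not-true (eqb-refl x))) ,
                          inj₂ (X'-skew x-lowest)
    ...   | yes (c , X'c , c≮x) with any? (λ h → (A h ≟B true) ×-dec ((below x h ≟B true) ×-dec
                                      any? (λ l → (A l ≟B true) ×-dec ((below l x ≟B true) ×-dec (before h l ≟B true)))))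
    ...     | yes straddle = ⊥-elim (no-straddle straddle)
    ...     | no ¬straddle = A-below-x , (λ q e → A⊆X q (proj₁ (∧-true-elim e))) , (c , ∧-true Ac c<x) ,
                             (x , Xx , ∧-falseˡ A-x) , inj₁ (A-below-x-sum ¬straddle)
      where
      c≢x : c ≢ x
      c≢x = delete-≢ {x} {X} X'c
      -- c is below x, which is below a₁ ∈ A, whereas points outside A lie above all of A.
      Ac : A c ≡ true
      Ac = bool-case (A c) (λ e → e) λ Ac≡false → ⊥-elim (true≢false
             (StrictTotalᵇ.transitive below-order x a₁ c (false⇒swap-true below-order (delete-≢ {x} {X} (A⊆X' a₁ Aa₁)) a₁≮x)
                                      (proj₂ (sum a₁ c Aa₁ X'c Ac≡false))) c≮x)
      c<x : below c x ≡ true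
      c<x = false⇒swap-true below-order (λ e → c≢x (sym e)) c≮x

flip-order : ∀ {N} {ℓ : Fin N → Fin N → Bool} → StrictTotalᵇ ℓ → StrictTotalᵇ (λ p q → ℓ q p)
flip-order {ℓ = ℓ} o = record { irrefl = StrictTotalᵇ.irrefl o ; swap = λ p q ne → StrictTotalᵇ.swap o q p (λ e → ne (sym e)) ;
                           transitive = λ p q r a b → StrictTotalᵇ.transitive o r q p b a }

-- A prime set of at least three points contains a prime 3142 or 2413

module PrimeSeed {N : ℕ} (below : Fin N → Fin N → Bool) (below-order : StrictTotalᵇ below) where
  open TwoOrders below below-order
  -- Reversing the value order swaps sum and skew blocks and turns 3142 into 2413.
  module Flipped = TwoOrders (λ p q → below q p) (flip-order below-order)

  prime-flip : ∀ X → Flipped.Prime X → Prime X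
  prime-flip X flipped-prime M m m' p sub M-module = flipped-prime M m m' p sub flipped-module
    where
    flipped-module : Flipped.IsModule X M
    flipped-module z m1 m2 Xz Mz M1 M2 = cong₂ _,_ (cong proj₁ e) (cong proj₂ (rel-flip n1 n2 e))
      where
      e = M-module z m1 m2 Xz Mz M1 M2
      n1 : z ≢ m1
      n1 refl = true≢false M1 Mz
      n2 : z ≢ m2
      n2 refl = true≢false M2 Mz

  NoPrime3142-flip : NoPrime3142 → Flipped.NoPrime3142
  NoPrime3142-flip no-3142 p1 p2 p3 p4 a b c Pf = no-3142 p1 p2 p3 p4 a b c (prime-flip _ Pf)

  Decomposable-flip : ∀ {X} → Flipped.Decomposable X → Decomposable X
  Decomposable-flip (A , s , a , b , inj₁ sm) = A , s , a , b , inj₂ sm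
  Decomposable-flip (A , s , a , b , inj₂ sk) = A , s , a , b , inj₁ sk

  no-prime-3142⇒decomposable : NoPrime3142 → ∀ f X → count X ≤ f → ∀ p q → X p ≡ true → X q ≡ true → p ≢ q → ¬ ¬ Decomposable X
  no-prime-3142⇒decomposable no-3142 zero X few p q Xp Xq pq ¬dec = ℕP.n≮0 (ℕP.<-≤-trans (count-strict (λ _ → false) X (λ _ ()) p refl Xp) few)
  no-prime-3142⇒decomposable no-3142 (suc f) X few p q Xp Xq pq ¬dec with max-element X p Xp
  ... | x , Xx , x-max = ¬¬-excluded-middle {A = Σ Point λ p' → Σ Point λ q' → (X' p' ≡ true) × (X' q' ≡ true) × (p' ≢ q')} by-size
    where
    X' = delete x X
    x-last : ∀ y → X y ≡ true → y ≢ x → before y x ≡ true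
    x-last y Xy yx = <⇒<ᵇ≡true (ℕP.≤∧≢⇒< (x-max y Xy) (λ e → yx (FP.toℕ-injective e)))
    fewer : count X' ≤ f
    fewer = ℕP.≤-pred (ℕP.<-≤-trans (count-strict X' X (λ q e → delete-⊆ {x} {X} e) x (∧-falseʳ {X x} (not-true (eqb-refl x))) Xx) few)
    by-size : _ → ⊥
    by-size (yes (p' , q' , X'p , X'q , pq')) = no-prime-3142⇒decomposable no-3142 f X' fewer p' q' X'p X'q pq' extend
      where
      extend : Decomposable X' → ⊥
      extend (A , sA , a , b , inj₁ sm) = ¬dec (SumExtension.decomposable no-3142 X x Xx x-last A sA a b sm)
      extend (A , sA , a , b , inj₂ sk) = ¬dec (Decomposable-flip (Flipped.SumExtension.decomposable (NoPrime3142-flip no-3142) X x Xx x-last A sA a b sk))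
    by-size (no no2) = case-≟ p x (λ px → two-point-block q Xq (λ e → pq (trans px (sym e)))) (λ px → two-point-block p Xp px)
      where
      two-point-block : ∀ y → X y ≡ true → y ≢ x → ⊥
      two-point-block y Xy yx = ¬dec (A , sA , (y , eqb-refl y) , (x , Xx , eqb-false (λ e → yx (sym e))) , direction (below y x) refl)
        where
        A : Subset
        A r = eqb r y
        sA : A ⊆ X
        sA r e = subst (λ t → X t ≡ true) (sym (eqb-true e)) Xy
        only-x : ∀ b → X b ≡ true → A b ≡ false → b ≡ x
        only-x b Xb Ab = case-≟ b x (λ e → e) (λ bx → ⊥-elim (no2 (b , y , delete-intro {x} {X} Xb bx , delete-intro {x} {X} Xy yx ,
                          λ e → true≢false (subst (λ t → A t ≡ true) (sym e) (eqb-refl y)) Ab)))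
        direction : ∀ bb → below y x ≡ bb → SumBlock X A ⊎ SkewBlock X A
        direction true e = inj₁ (λ a b Aa Xb Ab → case (eqb-true Aa) (only-x b Xb Ab))
          where
          case : ∀ {a b} → a ≡ y → b ≡ x → (before a b ≡ true) × (below a b ≡ true)
          case refl refl = x-last y Xy yx , e
        direction false e = inj₂ (λ a b Aa Xb Ab → case (eqb-true Aa) (only-x b Xb Ab))
          where
          case : ∀ {a b} → a ≡ y → b ≡ x → (before a b ≡ true) × (below b a ≡ true)
          case refl refl = x-last y Xy yx , false⇒swap-true below-order yx e

  block-view : ∀ {A} → SumBlock full A ⊎ SkewBlock full A → Bool × Bool
  block-view (inj₁ _) = false , false
  block-view (inj₂ _) = false , true

  view-of-block : ∀ {A} (block : SumBlock full A ⊎ SkewBlock full A) {z m} →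
                  A z ≡ false → A m ≡ true → rel z m ≡ block-view block
  view-of-block (inj₁ sum) {z} {m} Az Am = cong₂ _,_ (true⇒swap-false before-order {m} {z} (proj₁ (sum m z Am refl Az)))
                                                     (true⇒swap-false below-order {m} {z} (proj₂ (sum m z Am refl Az)))
  view-of-block (inj₂ skew) {z} {m} Az Am = cong₂ _,_ (true⇒swap-false before-order {m} {z} (proj₁ (skew m z Am refl Az)))
                                                      (proj₂ (skew m z Am refl Az))

  view-from-block : ∀ {A} (block : SumBlock full A ⊎ SkewBlock full A) {z m} →
                    A z ≡ true → A m ≡ false → rel z m ≡ opposite (block-view block)
  view-from-block block {z} {m} Az Am =
    trans (rel-swap λ { refl → true≢false Az Am }) (cong opposite (view-of-block block Am Az))

  -- A block with two points is a module; otherwise its complement is one.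
  decomposable-full-not-prime : Prime full → ThreePoints full → ¬ Decomposable full
  decomposable-full-not-prime V-prime T (A , _ , (a₀ , Aa₀) , (b₀ , _ , Ab₀) , block)
    with any? (λ a → (A a ≟B true) ×-dec ¬? (a ≟ a₀))
  ... | yes (a₁ , Aa₁ , a₁≢a₀) = V-prime A a₁ a₀ b₀ (λ _ _ → refl) A-module Aa₁ Aa₀ a₁≢a₀ refl Ab₀
    where
    A-module : IsModule full A
    A-module z m m' _ Az Am Am' = trans (view-of-block block Az Am) (sym (view-of-block block Az Am'))
  ... | no single with third T a₀ b₀
  ... | c₀ , _ , c₀≢a₀ , c₀≢b₀ =
    V-prime (compl A) b₀ c₀ a₀ (λ _ _ → refl) compl-module (not-false Ab₀) (not-false Ac₀) (λ e → c₀≢b₀ (sym e)) refl (not-true Aa₀)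
    where
    Ac₀ : A c₀ ≡ false
    Ac₀ = bool-case (A c₀) (λ e → ⊥-elim (single (c₀ , e , c₀≢a₀))) (λ e → e)
    compl-module : IsModule full (compl A)
    compl-module z m m' _ z∈A m∉A m'∉A = trans (view-from-block block (not-false-elim z∈A) (not-true-elim m∉A))
                                           (sym (view-from-block block (not-false-elim z∈A) (not-true-elim m'∉A)))

  prime-3142-exists : Prime full → ThreePoints full →
          ¬ ¬ (Σ Point λ p1 → Σ Point λ p2 → Σ Point λ p3 → Σ Point λ p4 →
               (before p1 p2 ≡ true) × (before p2 p3 ≡ true) × (before p3 p4 ≡ true) × Prime (four p1 p2 p3 p4))
  prime-3142-exists V-prime T ¬four = no-prime-3142⇒decomposable no-four N full (count≤size full) a b refl refl ab
                                        (decomposable-full-not-prime V-prime T)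
    where
    open ThreePoints T
    no-four : NoPrime3142
    no-four p₁ p₂ p₃ p₄ p₁<p₂ p₂<p₃ p₃<p₄ P = ¬four (p₁ , p₂ , p₃ , p₄ , p₁<p₂ , p₂<p₃ , p₃<p₄ , P)

-- Large prime subsets of a prime set

module SchmerlTrotter {N : ℕ} (below : Fin N → Fin N → Bool) (below-order : StrictTotalᵇ below) where
  open TwoOrders below below-order
  open PrimeSeed below below-order using (prime-3142-exists)

  count-delete : ∀ (P : Subset) a → count P ≤ count (delete a P) + 1
  count-delete P a = ℕP.≤-trans (count-mono P (λ q → delete a P q ∨ eqb q a) h)
                 (ℕP.≤-trans (count-∨ (delete a P) (λ q → eqb q a)) (ℕP.+-monoʳ-≤ (count (delete a P)) (count-singleton a)))
    where
    h : ∀ q → P q ≡ true → (delete a P q ∨ eqb q a) ≡ true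
    h q Pq = case-≟ q a (λ e → ∨-trueʳ {delete a P q} (subst (λ t → eqb q t ≡ true) e (eqb-refl q)))
                     (λ ne → ∨-trueˡ (delete-intro {a} {P} Pq ne))

  ¬ThreeOutside⇒N≤count+2 : ∀ Y → ¬ ThreeOutside Y → N ≤ count Y + 2
  ¬ThreeOutside⇒N≤count+2 Y ¬three =
    ℕP.≤-trans (ℕP.≤-reflexive (sym (count-compl Y))) (ℕP.+-monoʳ-≤ (count Y) few-outside)
    where
    Y' = compl Y
    few-outside : count Y' ≤ 2
    few-outside with 3 ℕ.≤? count Y'
    ... | no ≱3 = ℕP.≤-pred (ℕP.≰⇒> ≱3)
    ... | yes ≥3 with count>0⇒nonempty Y' (ℕP.≤-trans (s≤s z≤n) ≥3)
    ... | a , Y'a with count>0⇒nonempty (delete a Y') (ℕP.≤-trans (s≤s z≤n) (ℕP.+-cancelʳ-≤ 1 2 _ (ℕP.≤-trans ≥3 (count-delete Y' a))))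
    ... | b , Y'b with count>0⇒nonempty (delete b (delete a Y'))
                     (ℕP.+-cancelʳ-≤ 1 1 _ (ℕP.≤-trans (ℕP.+-cancelʳ-≤ 1 2 _ (ℕP.≤-trans ≥3 (count-delete Y' a)))
                        (count-delete (delete a Y') b)))
    ... | c , Y'c = ⊥-elim (¬three (a , b , c , not-true-elim Y'a , not-true-elim (delete-⊆ {a} {Y'} Y'b) ,
                     not-true-elim (delete-⊆ {a} {Y'} (delete-⊆ {b} {delete a Y'} Y'c)) ,
                     (λ e → delete-≢ {a} {Y'} Y'b (sym e)) ,
                     (λ e → delete-≢ {a} {Y'} (delete-⊆ {b} {delete a Y'} Y'c) (sym e)) ,
                     (λ e → delete-≢ {b} {delete a Y'} Y'c (sym e))))

  count-four : ∀ p₁ p₂ p₃ p₄ → count (four p₁ p₂ p₃ p₄) ≤ 4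
  count-four p₁ p₂ p₃ p₄ =
    ℕP.≤-trans (count-∨ (λ q → eqb q p₁) (λ q → eqb q p₂ ∨ (eqb q p₃ ∨ eqb q p₄)))
    (ℕP.+-mono-≤ (count-singleton p₁)
    (ℕP.≤-trans (count-∨ (λ q → eqb q p₂) (λ q → eqb q p₃ ∨ eqb q p₄))
    (ℕP.+-mono-≤ (count-singleton p₂)
    (ℕP.≤-trans (count-∨ (λ q → eqb q p₃) (λ q → eqb q p₄))
    (ℕP.+-mono-≤ (count-singleton p₃) (count-singleton p₄))))))

  four-proper : ∀ p₁ p₂ p₃ p₄ → 5 ≤ N → ∃ λ w → four p₁ p₂ p₃ p₄ w ≡ false
  four-proper p₁ p₂ p₃ p₄ 5≤N with any? (λ q → four p₁ p₂ p₃ p₄ q ≟B false)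
  ... | yes out = out
  ... | no ¬out = ⊥-elim (ℕP.<-irrefl refl (ℕP.<-≤-trans 5≤N (ℕP.≤-trans (ℕP.≤-reflexive (sym count-all))
                    (ℕP.≤-trans (count-mono full X all∈X) (count-four p₁ p₂ p₃ p₄)))))
    where
    X = four p₁ p₂ p₃ p₄
    all∈X : ∀ q → full q ≡ true → X q ≡ true
    all∈X q _ = bool-case (X q) (λ e → e) (λ e → ⊥-elim (¬out (q , e)))

  four-three : ∀ {p₁ p₂ p₃ p₄} → before p₁ p₂ ≡ true → before p₂ p₃ ≡ true → ThreePoints (four p₁ p₂ p₃ p₄)
  four-three {p₁} {p₂} {p₃} {p₄} p₁<p₂ p₂<p₃ =
    three p₁ p₂ p₃ (four-∋₁ p₁ p₂ p₃ p₄) (four-∋₂ p₁ p₂ p₃ p₄) (four-∋₃ p₁ p₂ p₃ p₄)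
          (true⇒≢ before-order p₁<p₂) (true⇒≢ before-order (StrictTotalᵇ.transitive before-order p₁ p₂ p₃ p₁<p₂ p₂<p₃))
          (true⇒≢ before-order p₂<p₃)

  three-points : 3 ≤ N → ThreePoints full
  three-points (s≤s (s≤s (s≤s _))) =
    three F.zero (F.suc F.zero) (F.suc (F.suc F.zero)) refl refl refl (λ ()) (λ ()) (λ ())

  -- Grow a prime four-point seed until at most two points are missing.
  prime-sub-missing-two : Prime full → 5 ≤ N →
          ¬ ¬ (Σ Subset λ Y → Prime Y × (∃ λ w → Y w ≡ false) × (N ≤ count Y + 2))
  prime-sub-missing-two V-prime 5≤N ¬Y = prime-3142-exists V-prime (three-points (ℕP.≤-trans (ℕP.m≤n+m 3 2) 5≤N))
    λ (p₁ , p₂ , p₃ , p₄ , p₁<p₂ , p₂<p₃ , _ , four-prime) →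
      grow N (count≤size _) V-prime four-prime (four-three p₁<p₂ p₂<p₃) (four-proper p₁ p₂ p₃ p₄ 5≤N)
        λ (Y , Y-prime , out , ¬three) → ¬Y (Y , Y-prime , out , ¬ThreeOutside⇒N≤count+2 Y ¬three)

  prime-subset-larger-than : Prime full → ∀ k → k + 2 < N →
          ¬ ¬ (Σ Subset λ Y → Prime Y × (∃ λ w → Y w ≡ false) × k < count Y)
  prime-subset-larger-than PV k k+2<N ¬Y with k ℕ.≤? 1 | three-points (ℕP.≤-trans (s≤s (ℕP.m≤n+m 2 k)) k+2<N)
  ... | yes k≤1 | three p₀ p₁ p₂ _ _ _ p₀≢p₁ p₀≢p₂ p₁≢p₂ =
    ¬Y (pair p₀ p₁ , pair-prime p₀ p₁ , (p₂ , ∨-false (eqb-false (λ e → p₀≢p₂ (sym e))) (eqb-false (λ e → p₁≢p₂ (sym e)))) ,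
        ℕP.≤-trans (s≤s k≤1) (count-pair p₀≢p₁))
  ... | no k≰1 | _ = prime-sub-missing-two PV 5≤N λ { (Y , PY , out , N≤Y+2) →
    ¬Y (Y , PY , out , ℕP.+-cancelʳ-≤ 2 (suc k) (count Y) (ℕP.≤-trans k+2<N N≤Y+2)) }
    where
    5≤N : 5 ≤ N
    5≤N = ℕP.≤-trans (ℕP.+-monoˡ-≤ 3 (ℕP.≰⇒> k≰1)) (subst (_≤ N) (sym (ℕP.+-suc k 2)) k+2<N)

-- Permutations as pairs of orders, patterns and intervals

<ᵇ-cong : ∀ {a b c d : ℕ} → (a < b → c < d) → (c < d → a < b) → (a <ᵇ b) ≡ (c <ᵇ d)
<ᵇ-cong {a} {b} {c} {d} f g with a <ᵇ b in e1 | c <ᵇ d in e2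
... | true | true = refl
... | false | false = refl
... | true | false = ⊥-elim (true≢false (<⇒<ᵇ≡true (f (<ᵇ≡true⇒< {a} {b} e1))) e2)
... | false | true = ⊥-elim (true≢false (<⇒<ᵇ≡true (g (<ᵇ≡true⇒< {c} {d} e2))) e1)

pigeonhole-ℕ : ∀ k m (f : ℕ → ℕ) → (∀ i → i < k → f i < m) →
             (∀ i j → i < k → j < k → f i ≡ f j → i ≡ j) → k ≤ m
pigeonhole-ℕ k m f bd inj = FP.injective⇒≤ {f = g} ginj
  where
  g : Fin k → Fin m
  g i = fromℕ< (bd (toℕ i) (FP.toℕ<n i))
  ginj : Injective _≡_ _≡_ g
  ginj {i} {j} e = FP.toℕ-injective (inj (toℕ i) (toℕ j) (FP.toℕ<n i) (FP.toℕ<n j)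
    (trans (sym (FP.toℕ-fromℕ< _)) (trans (cong toℕ e) (FP.toℕ-fromℕ< _))))

≼-refl : ∀ π → π ≼ π
≼-refl π = (λ i → i) , (λ i j lt → lt) , (λ i j → (λ x → x) , (λ x → x))

≼-trans : ∀ {α β γ} → α ≼ β → β ≼ γ → α ≼ γ
≼-trans (g , gm , gi) (h , hm , hi) = (λ i → h (g i)) , (λ i j lt → hm _ _ (gm i j lt)) ,
  (λ i j → (λ lt → proj₁ (hi (g i) (g j)) (proj₁ (gi i j) lt)) , (λ lt → proj₂ (gi i j) (proj₂ (hi (g i) (g j)) lt)))

enum : ∀ {N} (X : Fin N → Bool) → Fin (count X) → Fin N
enum {suc N} X i with X F.zero
enum {suc N} X F.zero | true = F.zero
enum {suc N} X (F.suc i) | true = F.suc (enum (λ j → X (F.suc j)) i)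
enum {suc N} X i | false = F.suc (enum (λ j → X (F.suc j)) i)

enum-in : ∀ {N} (X : Fin N → Bool) i → X (enum X i) ≡ true
enum-in {suc N} X i with X F.zero in e
enum-in {suc N} X F.zero | true = e
enum-in {suc N} X (F.suc i) | true = enum-in (λ j → X (F.suc j)) i
enum-in {suc N} X i | false = enum-in (λ j → X (F.suc j)) i

enum-mono : ∀ {N} (X : Fin N → Bool) i j → toℕ i < toℕ j → toℕ (enum X i) < toℕ (enum X j)
enum-mono {suc N} X i j lt with X F.zero
enum-mono {suc N} X F.zero (F.suc j) lt | true = s≤s z≤n
enum-mono {suc N} X (F.suc i) (F.suc j) (s≤s lt) | true = s≤s (enum-mono (λ j → X (F.suc j)) i j lt)
enum-mono {suc N} X i j lt | false = s≤s (enum-mono (λ j → X (F.suc j)) i j lt)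

enum-surj : ∀ {N} (X : Fin N → Bool) p → X p ≡ true → ∃ λ i → enum X i ≡ p
enum-surj {suc N} X p Xp with X F.zero in e
enum-surj {suc N} X F.zero Xp | true = F.zero , refl
enum-surj {suc N} X (F.suc p) Xp | true with enum-surj (λ j → X (F.suc j)) p Xp
... | i , ei = F.suc i , cong F.suc ei
enum-surj {suc N} X F.zero Xp | false = ⊥-elim (true≢false Xp e)
enum-surj {suc N} X (F.suc p) Xp | false with enum-surj (λ j → X (F.suc j)) p Xp
... | i , ei = i , cong F.suc ei

strictly-monotone⇒injective : ∀ {n m} (g : Fin n → Fin m) → (∀ i j → toℕ i < toℕ j → toℕ (g i) < toℕ (g j)) → Injective _≡_ _≡_ g
strictly-monotone⇒injective g mono {i} {j} e with ℕP.<-cmp (toℕ i) (toℕ j)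
... | tri< a _ _ = ⊥-elim (ℕP.<-irrefl (cong toℕ e) (mono i j a))
... | tri≈ _ b _ = FP.toℕ-injective b
... | tri> _ _ c = ⊥-elim (ℕP.<-irrefl (cong toℕ (sym e)) (mono j i c))

strictly-monotone-reflects : ∀ {n m} (g : Fin n → Fin m) → (∀ i j → toℕ i < toℕ j → toℕ (g i) < toℕ (g j)) →
            ∀ i j → toℕ (g i) < toℕ (g j) → toℕ i < toℕ j
strictly-monotone-reflects g mono i j a with ℕP.<-cmp (toℕ i) (toℕ j)
... | tri< x _ _ = x
... | tri≈ _ y _ = ⊥-elim (ℕP.<-irrefl (cong (λ t → toℕ (g t)) (FP.toℕ-injective y)) a)
... | tri> _ _ z = ⊥-elim (ℕP.<-asym a (mono j i z))

-- Each point is sent to the rank of its image under f.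
module Standardisation {m n : ℕ} (f : Fin m → Fin n) (f-injective : Injective _≡_ _≡_ f) where
  private
    f-order = injective-order f f-injective

  rank : Fin m → ℕ
  rank j = count (λ i → toℕ (f i) <ᵇ toℕ (f j))

  rank-< : ∀ j → rank j < m
  rank-< j = ℕP.<-≤-trans (count-strict _ (λ _ → true) (λ _ _ → refl) j (StrictTotalᵇ.irrefl f-order j) refl) (count≤size _)

  rank-mono : ∀ i j → toℕ (f i) < toℕ (f j) → rank i < rank j
  rank-mono i j fi<fj = count-strict _ _ (λ t t<i → StrictTotalᵇ.transitive f-order t i j t<i (<⇒<ᵇ≡true fi<fj))
                          i (StrictTotalᵇ.irrefl f-order i) (<⇒<ᵇ≡true fi<fj)

  rank-reflects : ∀ i j → rank i < rank j → toℕ (f i) < toℕ (f j)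
  rank-reflects i j r with ℕP.<-cmp (toℕ (f i)) (toℕ (f j))
  ... | tri< lt _ _ = lt
  ... | tri≈ _ eq _ = ⊥-elim (ℕP.<-irrefl (cong rank (f-injective (FP.toℕ-injective eq))) r)
  ... | tri> _ _ gt = ⊥-elim (ℕP.<-asym r (rank-mono j i gt))

  rank-fin : Fin m → Fin m
  rank-fin j = fromℕ< (rank-< j)

  toℕ-rank-fin : ∀ j → toℕ (rank-fin j) ≡ rank j
  toℕ-rank-fin j = FP.toℕ-fromℕ< _

  iso→ : ∀ i j → toℕ (f i) < toℕ (f j) → rank-fin i F.< rank-fin j
  iso→ i j fi<fj = subst₂ _<_ (sym (toℕ-rank-fin i)) (sym (toℕ-rank-fin j)) (rank-mono i j fi<fj)

  iso← : ∀ i j → rank-fin i F.< rank-fin j → toℕ (f i) < toℕ (f j)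
  iso← i j ri<rj = rank-reflects i j (subst₂ _<_ (toℕ-rank-fin i) (toℕ-rank-fin j) ri<rj)

  rank-fin-injective : Injective _≡_ _≡_ rank-fin
  rank-fin-injective {i} {j} e with ℕP.<-cmp (toℕ (f i)) (toℕ (f j))
  ... | tri< lt _ _ = ⊥-elim (ℕP.<-irrefl (cong toℕ e) (iso→ i j lt))
  ... | tri≈ _ eq _ = f-injective (FP.toℕ-injective eq)
  ... | tri> _ _ gt = ⊥-elim (ℕP.<-irrefl (cong toℕ (sym e)) (iso→ j i gt))

  standardised : Perm
  standardised = perm m rank-fin rank-fin-injective

enum-inj : ∀ {N} (X : Fin N → Bool) → Injective _≡_ _≡_ (enum X)
enum-inj X = strictly-monotone⇒injective (enum X) (enum-mono X)

lowerᵇ : (π : Perm) → Fin (len π) → Fin (len π) → Bool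
lowerᵇ π p q = toℕ (fn π p) <ᵇ toℕ (fn π q)

lower-order : (π : Perm) → StrictTotalᵇ (lowerᵇ π)
lower-order π = injective-order (fn π) (inj π)

module PermOrders (π : Perm) = TwoOrders (lowerᵇ π) (lower-order π)

module RestrictionOf (β : Perm) (X : Fin (len β) → Bool) where
  g : Fin (count X) → Fin (len β)
  g = enum X

  open Standardisation (λ i → fn β (g i)) (λ e → enum-inj X (inj β e)) public

  restriction : Perm
  restriction = standardised

  restriction-shorter : ∀ {w} → X w ≡ false → len restriction < len β
  restriction-shorter {w} Xw = ℕP.<-≤-trans (count-strict X (λ _ → true) (λ _ _ → refl) w Xw refl) (count≤size (λ _ → true))

  restriction≼ : restriction ≼ β
  restriction≼ = g , (λ i j i<j → enum-mono X i j i<j) , (λ i j → iso← i j , iso→ i j)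

  module Cβ = PermOrders β
  module Cγ = PermOrders restriction

  rel-eq : ∀ i j → Cγ.rel i j ≡ Cβ.rel (g i) (g j)
  rel-eq i j = cong₂ _,_ (<ᵇ-cong (enum-mono X i j) (strictly-monotone-reflects g (enum-mono X) i j))
                         (<ᵇ-cong (iso← i j) (iso→ i j))

  -- A module of the restriction is carried by g to a module of X.
  prime-restriction : Cβ.Prime X → Cγ.Prime Cγ.full
  prime-restriction X-prime M m1 m2 p M⊆ M-module M1 M2 m12 _ Mp =
    X-prime image (g m1) (g m2) (g p) image⊆X image-module (image-intro M1) (image-intro M2)
            (λ e → m12 (enum-inj X e)) (enum-in X p) image-p
    where
    image? : ∀ q → Dec (∃ λ i → (g i ≡ q) × (M i ≡ true))
    image? q = any? (λ i → (g i ≟ q) ×-dec (M i ≟B true))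
    image : Fin (len β) → Bool
    image q = does (image? q)
    image-intro : ∀ {i} → M i ≡ true → image (g i) ≡ true
    image-intro {i} Mi = ⇒does-true (image? (g i)) (i , refl , Mi)
    image-elim : ∀ {q} → image q ≡ true → ∃ λ i → (g i ≡ q) × (M i ≡ true)
    image-elim {q} e = does-true⇒ (image? q) e
    image-p : image (g p) ≡ false
    image-p = bool-case (image (g p)) (λ e → case (image-elim e)) (λ e → e)
      where
      case : (∃ λ i → (g i ≡ g p) × (M i ≡ true)) → image (g p) ≡ false
      case (i , gi , Mi) = ⊥-elim (true≢false (subst (λ t → M t ≡ true) (enum-inj X gi) Mi) Mp)
    image⊆X : image Cβ.⊆ X
    image⊆X q e with image-elim e
    ... | i , refl , _ = enum-in X i
    image-module : Cβ.IsModule X image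
    image-module z m m' Xz Mz Mm Mm' with image-elim Mm | image-elim Mm' | enum-surj X z Xz
    ... | i , refl , Mi | i' , refl , Mi' | j , refl =
      trans (sym (rel-eq j i))
            (trans (M-module j i i' refl (bool-case (M j) (λ e → ⊥-elim (true≢false (image-intro e) Mz)) (λ e → e)) Mi Mi')
                   (rel-eq j i'))

module Intervals (π : Perm) where
  n = len π
  val : Fin n → ℕ
  val p = toℕ (fn π p)

  -- The value at position x, as a total function on ℕ (junk 0 when x ≥ n).
  valueℕ : ℕ → ℕ
  valueℕ x with x ℕ.<? n
  ... | yes lt = val (fromℕ< lt)
  ... | no _ = 0

  valueℕ-toℕ : ∀ p → valueℕ (toℕ p) ≡ val p
  valueℕ-toℕ p with toℕ p ℕ.<? n
  ... | yes lt = cong val (FP.fromℕ<-toℕ p lt)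
  ... | no ne = ⊥-elim (ne (FP.toℕ<n p))

  valueℕ-injective : ∀ x y → x < n → y < n → valueℕ x ≡ valueℕ y → x ≡ y
  valueℕ-injective x y lx ly e =
    trans (sym (FP.toℕ-fromℕ< lx)) (trans (cong toℕ (inj π (FP.toℕ-injective
      (trans (sym (valueℕ-toℕ (fromℕ< lx))) (trans (cong valueℕ (FP.toℕ-fromℕ< lx)) (trans e
        (trans (cong valueℕ (sym (FP.toℕ-fromℕ< ly))) (valueℕ-toℕ (fromℕ< ly))))))))) (FP.toℕ-fromℕ< ly))

  ∸-< : ∀ {v c w} → c ≤ v → v < c + w → v ∸ c < w
  ∸-< {v} {c} {w} cv lt = subst (λ t → v ∸ c < t) (ℕP.m+n∸m≡n c w) (ℕP.∸-monoˡ-< lt cv)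

  ValuesIn : ℕ → ℕ → ℕ → Set
  ValuesIn a b c = ∀ (p : Fin n) → a ≤ toℕ p → toℕ p < b → (c ≤ val p) × (val p < c + (b ∸ a))

  -- Pigeonhole: the b ∸ a positions of the interval together with z would carry
  -- b ∸ a + 1 distinct values in [c, c + (b ∸ a)).
  values-outside : ∀ a b c → a ≤ b → b ≤ n → ValuesIn a b c → ∀ z → (toℕ z < a ⊎ b ≤ toℕ z) →
           c ≤ val z → val z < c + (b ∸ a) → ⊥
  values-outside a b c a≤b b≤n values z z-outside c≤z z<c+w = ℕP.<-irrefl refl (pigeonhole-ℕ (suc (b ∸ a)) (b ∸ a) offset offset-< offset-injective)
    where
    w = b ∸ a
    a+i<b : ∀ i → i < w → a + i < b
    a+i<b i lt = subst (λ t → a + i < t) (ℕP.m+[n∸m]≡n a≤b) (ℕP.+-monoʳ-< a lt)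
    position : ℕ → ℕ
    position i with i ℕ.<? w
    ... | yes _ = a + i
    ... | no _ = toℕ z
    position-< : ∀ i → position i < n
    position-< i with i ℕ.<? w
    ... | yes lt = ℕP.<-≤-trans (a+i<b i lt) b≤n
    ... | no _ = FP.toℕ<n z
    position-value : ∀ i → (c ≤ valueℕ (position i)) × (valueℕ (position i) < c + w)
    position-value i with i ℕ.<? w
    ... | yes lt = subst (λ t → (c ≤ t) × (t < c + w)) (sym (trans (cong valueℕ (sym (FP.toℕ-fromℕ< a+i<n))) (valueℕ-toℕ (fromℕ< a+i<n))))
                     (values (fromℕ< a+i<n) (subst (a ≤_) (sym (FP.toℕ-fromℕ< a+i<n)) (ℕP.m≤m+n a i))
                                     (subst (_< b) (sym (FP.toℕ-fromℕ< a+i<n)) (a+i<b i lt)))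
      where a+i<n = ℕP.<-≤-trans (a+i<b i lt) b≤n
    ... | no _ = subst (λ t → (c ≤ t) × (t < c + w)) (sym (valueℕ-toℕ z)) (c≤z , z<c+w)
    offset : ℕ → ℕ
    offset i = valueℕ (position i) ∸ c
    offset-< : ∀ i → i < suc w → offset i < w
    offset-< i _ = ∸-< (proj₁ (position-value i)) (proj₂ (position-value i))
    not-outside : (toℕ z < a ⊎ b ≤ toℕ z) → a ≤ toℕ z → toℕ z < b → ⊥
    not-outside (inj₁ x) p q = ℕP.<-irrefl refl (ℕP.<-≤-trans x p)
    not-outside (inj₂ y) p q = ℕP.<-irrefl refl (ℕP.<-≤-trans q y)
    position-injective : ∀ i j → i < suc w → j < suc w → position i ≡ position j → i ≡ j
    position-injective i j li lj e with i ℕ.<? w | j ℕ.<? w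
    ... | yes _ | yes _ = ℕP.+-cancelˡ-≡ a _ _ e
    ... | no ni | no nj = trans (ℕP.≤-antisym (ℕP.≤-pred li) (ℕP.≮⇒≥ ni)) (sym (ℕP.≤-antisym (ℕP.≤-pred lj) (ℕP.≮⇒≥ nj)))
    ... | yes lt | no _ = ⊥-elim (not-outside z-outside (subst (a ≤_) e (ℕP.m≤m+n a i)) (subst (_< b) e (a+i<b i lt)))
    ... | no _ | yes lt = ⊥-elim (not-outside z-outside (subst (a ≤_) (sym e) (ℕP.m≤m+n a j)) (subst (_< b) (sym e) (a+i<b j lt)))
    offset-injective : ∀ i j → i < suc w → j < suc w → offset i ≡ offset j → i ≡ j
    offset-injective i j li lj e = position-injective i j li lj (valueℕ-injective _ _ (position-< i) (position-< j)
                         (ℕP.∸-cancelʳ-≡ (proj₁ (position-value i)) (proj₁ (position-value j)) e))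

  module Cπ = PermOrders π

  between : ℕ → ℕ → Fin n → Bool
  between a b q = not (toℕ q <ᵇ a) ∧ (toℕ q <ᵇ b)

  between-elim : ∀ {a b q} → between a b q ≡ true → (a ≤ toℕ q) × (toℕ q < b)
  between-elim {a} {b} {q} e = <ᵇ≡false⇒≤ {toℕ q} {a} (not-true-elim (proj₁ (∧-true-elim e))) ,
                                <ᵇ≡true⇒< {toℕ q} {b} (proj₂ (∧-true-elim {not (toℕ q <ᵇ a)} e))

  between-intro : ∀ {a b q} → a ≤ toℕ q → toℕ q < b → between a b q ≡ true
  between-intro {a} {b} {q} x y = ∧-true (not-false (≤⇒<ᵇ≡false {toℕ q} {a} x)) (<⇒<ᵇ≡true y)

  between-false : ∀ {a b q} → between a b q ≡ false → (toℕ q < a) ⊎ (b ≤ toℕ q)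
  between-false {a} {b} {q} e with ℕP.<-cmp (toℕ q) a | ℕP.<-cmp (toℕ q) b
  ... | tri< x _ _ | _ = inj₁ x
  ... | _ | tri≈ _ y _ = inj₂ (ℕP.≤-reflexive (sym y))
  ... | _ | tri> _ _ y = inj₂ (ℕP.<⇒≤ y)
  ... | tri≈ _ x _ | tri< y _ _ = ⊥-elim (true≢false (between-intro {a} {b} {q} (ℕP.≤-reflexive (sym x)) y) e)
  ... | tri> _ _ x | tri< y _ _ = ⊥-elim (true≢false (between-intro {a} {b} {q} (ℕP.<⇒≤ x) y) e)

  interval-module : ∀ {a b} → IsInterval π a b → Cπ.IsModule Cπ.full (between a b)
  interval-module {a} {b} (ab , bn , c , hv) z m m' _ Mz Mm Mm' = cong₂ _,_ c1 c2
    where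
    w = b ∸ a
    im = between-elim {a} {b} {m} Mm
    im' = between-elim {a} {b} {m'} Mm'
    oz = between-false {a} {b} {z} Mz
    c1 : before z m ≡ before z m'
    c1 with oz
    ... | inj₁ x = trans (<⇒<ᵇ≡true (ℕP.<-≤-trans x (proj₁ im))) (sym (<⇒<ᵇ≡true (ℕP.<-≤-trans x (proj₁ im'))))
    ... | inj₂ y = trans (≤⇒<ᵇ≡false (ℕP.≤-trans (ℕP.<⇒≤ (proj₂ im)) y))
                         (sym (≤⇒<ᵇ≡false (ℕP.≤-trans (ℕP.<⇒≤ (proj₂ im')) y)))
    vm = hv m (proj₁ im) (proj₂ im)
    vm' = hv m' (proj₁ im') (proj₂ im')
    c2 : lowerᵇ π z m ≡ lowerᵇ π z m'
    c2 with c ℕ.≤? val z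
    ... | no nc = trans (<⇒<ᵇ≡true (ℕP.<-≤-trans (ℕP.≰⇒> nc) (proj₁ vm)))
                        (sym (<⇒<ᵇ≡true (ℕP.<-≤-trans (ℕP.≰⇒> nc) (proj₁ vm'))))
    ... | yes cz with val z ℕ.<? c + w
    ... | yes zl = ⊥-elim (values-outside a b c ab bn hv z oz cz zl)
    ... | no zl = trans (≤⇒<ᵇ≡false (ℕP.≤-trans (ℕP.<⇒≤ (proj₂ vm)) (ℕP.≮⇒≥ zl)))
                        (sym (≤⇒<ᵇ≡false (ℕP.≤-trans (ℕP.<⇒≤ (proj₂ vm')) (ℕP.≮⇒≥ zl))))

  module NontrivialInterval {a b : ℕ} (a≤b : a ≤ b) (b≤n : b ≤ n) (two : 2 ≤ b ∸ a) (partial : b ∸ a ≢ n) where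

    a+1<b : suc a < b
    a+1<b = subst (_≤ b) (ℕP.+-comm a 2) (subst (a + 2 ≤_) (ℕP.m+[n∸m]≡n a≤b) (ℕP.+-monoʳ-≤ a two))

    a<n : a < n
    a<n = ℕP.<-≤-trans (ℕP.<-trans (ℕP.n<1+n a) a+1<b) b≤n

    first second : Fin n
    first = fromℕ< a<n
    second = fromℕ< (ℕP.<-≤-trans a+1<b b≤n)

    toℕ-first : toℕ first ≡ a
    toℕ-first = FP.toℕ-fromℕ< a<n

    toℕ-second : toℕ second ≡ suc a
    toℕ-second = FP.toℕ-fromℕ< _

    first∈ : between a b first ≡ true
    first∈ = between-intro {a} {b} {first} (ℕP.≤-reflexive (sym toℕ-first))
                           (subst (_< b) (sym toℕ-first) (ℕP.<-trans (ℕP.n<1+n a) a+1<b))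

    second∈ : between a b second ≡ true
    second∈ = between-intro {a} {b} {second} (subst (a ≤_) (sym toℕ-second) (ℕP.n≤1+n a)) (subst (_< b) (sym toℕ-second) a+1<b)

    first≢second : first ≢ second
    first≢second e = ℕP.<⇒≢ (ℕP.n<1+n a) (trans (sym toℕ-first) (trans (cong toℕ e) toℕ-second))

    outside : Σ (Fin n) λ p → between a b p ≡ false
    outside with 0 ℕ.<? a
    ... | yes a>0 = fromℕ< (ℕP.<-trans a>0 a<n) ,
                    ∧-falseˡ (not-true (<⇒<ᵇ≡true (subst (_< a) (sym (FP.toℕ-fromℕ< (ℕP.<-trans a>0 a<n))) a>0)))
    ... | no a≯0 = fromℕ< b<n , ∧-falseʳ {not (toℕ (fromℕ< b<n) <ᵇ a)}
                                          (≤⇒<ᵇ≡false {toℕ (fromℕ< b<n)} {b} (ℕP.≤-reflexive (sym (FP.toℕ-fromℕ< b<n))))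
      where
      b<n : b < n
      b<n = ℕP.≤∧≢⇒< b≤n (λ e → partial (trans (cong (b ∸_) (ℕP.n≤0⇒n≡0 (ℕP.≮⇒≥ a≯0))) e))

  prime⇒simple : Cπ.Prime Cπ.full → Simple π
  prime⇒simple π-prime a b iv@(a≤b , b≤n , _) with (b ∸ a) ℕ.≤? 1 | (b ∸ a) ℕ.≟ n
  ... | yes small | _ = inj₁ small
  ... | no _ | yes whole = inj₂ whole
  ... | no big | no partial =
    ⊥-elim (π-prime (between a b) first second (proj₁ outside) (λ _ _ → refl) (interval-module iv) first∈ second∈
                    first≢second refl (proj₂ outside))
    where open NontrivialInterval a≤b b≤n (ℕP.≰⇒> big) partial

  value⁻¹ : ∀ {v} → v < n → Fin n
  value⁻¹ lt = proj₁ (injective⇒surjective (fn π) (inj π) (fromℕ< lt))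

  val-value⁻¹ : ∀ {v} (lt : v < n) → val (value⁻¹ lt) ≡ v
  val-value⁻¹ lt = trans (cong toℕ (proj₂ (injective⇒surjective (fn π) (inj π) (fromℕ< lt)))) (FP.toℕ-fromℕ< lt)

  -- The position holding value v, as a total function on ℕ (junk 0 when v ≥ n).
  positionℕ : ℕ → ℕ
  positionℕ v with v ℕ.<? n
  ... | yes lt = toℕ (value⁻¹ lt)
  ... | no _ = 0

  positionℕ-value⁻¹ : ∀ {v} (lt : v < n) → positionℕ v ≡ toℕ (value⁻¹ lt)
  positionℕ-value⁻¹ {v} lt with v ℕ.<? n
  ... | yes lt' = cong (λ t → toℕ (value⁻¹ {v} t)) (ℕP.<-irrelevant lt' lt)
  ... | no ne = ⊥-elim (ne lt)

  module ModuleInterval {M : Fin n → Bool} (M-module : Cπ.IsModule Cπ.full M) {m₀ : Fin n} (Mm₀ : M m₀ ≡ true) where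

    private
      first = min-element-by toℕ M m₀ Mm₀
      last = max-element M m₀ Mm₀
      lowest = min-element-by val M m₀ Mm₀

    a b c : ℕ
    a = toℕ (proj₁ first)
    b = suc (toℕ (proj₁ last))
    c = val (proj₁ lowest)

    a≤ : ∀ q → M q ≡ true → a ≤ toℕ q
    a≤ = proj₂ (proj₂ first)

    <b : ∀ q → M q ≡ true → toℕ q < b
    <b q Mq = s≤s (proj₂ (proj₂ last) q Mq)

    c≤ : ∀ q → M q ≡ true → c ≤ val q
    c≤ = proj₂ (proj₂ lowest)

    a≤b : a ≤ b
    a≤b = ℕP.<⇒≤ (<b _ (proj₁ (proj₂ first)))

    b≤n : b ≤ n
    b≤n = FP.toℕ<n (proj₁ last)

    -- A non-member between the first and last member would separate them by position.
    member-by-position : ∀ q → a ≤ toℕ q → toℕ q < b → M q ≡ true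
    member-by-position q a≤q q<b = bool-case (M q) (λ e → e) λ Mq →
      ⊥-elim (true≢false (trans (cong proj₁ (M-module q (proj₁ first) (proj₁ last) refl Mq (proj₁ (proj₂ first)) Mlast))
                                (<⇒<ᵇ≡true (ℕP.≤∧≢⇒< (ℕP.≤-pred q<b) (q≢last Mq))))
                         (≤⇒<ᵇ≡false {toℕ q} {a} a≤q))
      where
      Mlast = proj₁ (proj₂ last)
      q≢last : M q ≡ false → toℕ q ≢ toℕ (proj₁ last)
      q≢last Mq e = true≢false (subst (λ t → M t ≡ true) (sym (FP.toℕ-injective e)) Mlast) Mq

    -- A non-member valued between the lowest member and a member q would separate them by value.
    member-by-value : ∀ {q} → M q ≡ true → ∀ r → c ≤ val r → val r ≤ val q → M r ≡ true
    member-by-value {q} Mq r c≤r r≤q = bool-case (M r) (λ e → e) λ Mr →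
      ⊥-elim (true≢false (trans (cong proj₂ (M-module r (proj₁ lowest) q refl Mr (proj₁ (proj₂ lowest)) Mq))
                                (<⇒<ᵇ≡true (ℕP.≤∧≢⇒< r≤q (r≢q Mr))))
                         (≤⇒<ᵇ≡false {val r} {c} c≤r))
      where
      r≢q : M r ≡ false → val r ≢ val q
      r≢q Mr e = true≢false (subst (λ t → M t ≡ true) (inj π (FP.toℕ-injective (sym e))) Mq) Mr

    -- The values c, …, val q are all taken by members, i.e. at positions in [a, b).
    values-in-range : ValuesIn a b c
    values-in-range q a≤q q<b = c≤ q Mq , subst (_< c + (b ∸ a)) (ℕP.m+[n∸m]≡n (c≤ q Mq)) (ℕP.+-monoʳ-< c d<b-a)
      where
      Mq = member-by-position q a≤q q<b
      d = val q ∸ c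
      c+i≤q : ∀ {i} → i < suc d → c + i ≤ val q
      c+i≤q i≤d = subst (_ ≤_) (ℕP.m+[n∸m]≡n (c≤ q Mq)) (ℕP.+-monoʳ-≤ c (ℕP.≤-pred i≤d))
      c+i<n : ∀ {i} → i < suc d → c + i < n
      c+i<n i≤d = ℕP.≤-<-trans (c+i≤q i≤d) (FP.toℕ<n (fn π q))
      r : ∀ {i} → i < suc d → Fin n
      r i≤d = value⁻¹ (c+i<n i≤d)
      val-r : ∀ {i} (i≤d : i < suc d) → val (r i≤d) ≡ c + i
      val-r i≤d = val-value⁻¹ (c+i<n i≤d)
      Mr : ∀ {i} (i≤d : i < suc d) → M (r i≤d) ≡ true
      Mr {i} i≤d = member-by-value Mq (r i≤d) (subst (c ≤_) (sym (val-r i≤d)) (ℕP.m≤m+n c i))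
                                              (subst (_≤ val q) (sym (val-r i≤d)) (c+i≤q i≤d))
      offset : ℕ → ℕ
      offset i = positionℕ (c + i) ∸ a
      offset-r : ∀ {i} (i≤d : i < suc d) → offset i ≡ toℕ (r i≤d) ∸ a
      offset-r i≤d = cong (_∸ a) (positionℕ-value⁻¹ (c+i<n i≤d))
      offset-< : ∀ i → i < suc d → offset i < b ∸ a
      offset-< i i≤d = subst (_< b ∸ a) (sym (offset-r i≤d)) (ℕP.∸-monoˡ-< (<b _ (Mr i≤d)) (a≤ _ (Mr i≤d)))
      offset-injective : ∀ i j → i < suc d → j < suc d → offset i ≡ offset j → i ≡ j
      offset-injective i j i≤d j≤d e = ℕP.+-cancelˡ-≡ c _ _ (trans (sym (val-r i≤d)) (trans (cong val rᵢ≡rⱼ) (val-r j≤d)))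
        where
        rᵢ≡rⱼ : r i≤d ≡ r j≤d
        rᵢ≡rⱼ = FP.toℕ-injective (ℕP.∸-cancelʳ-≡ (a≤ _ (Mr i≤d)) (a≤ _ (Mr j≤d))
                  (trans (sym (offset-r i≤d)) (trans e (offset-r j≤d))))
      d<b-a : d < b ∸ a
      d<b-a = pigeonhole-ℕ (suc d) (b ∸ a) offset offset-< offset-injective

    interval : IsInterval π a b
    interval = a≤b , b≤n , c , values-in-range

    trivial⇒not-proper : ∀ {m₁ p} → M m₁ ≡ true → m₀ ≢ m₁ → M p ≡ false → (b ∸ a ≤ 1) ⊎ (b ∸ a ≡ n) → ⊥
    trivial⇒not-proper {m₁} Mm₁ m₀≢m₁ _ (inj₁ b-a≤1) = m₀≢m₁ (FP.toℕ-injective (trans (at-a Mm₀) (sym (at-a Mm₁))))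
      where
      last≤a : toℕ (proj₁ last) ≤ a
      last≤a = ℕP.m∸n≡0⇒m≤n (ℕP.n≤0⇒n≡0 (ℕP.≤-pred
                 (subst (_≤ 1) (ℕP.+-∸-assoc 1 (ℕP.≤-pred (<b _ (proj₁ (proj₂ first))))) b-a≤1)))
      at-a : ∀ {t} → M t ≡ true → toℕ t ≡ a
      at-a {t} Mt = ℕP.≤-antisym (ℕP.≤-trans (ℕP.≤-pred (<b t Mt)) last≤a) (a≤ t Mt)
    trivial⇒not-proper {p = p} _ _ Mp (inj₂ b-a≡n) = true≢false (member-by-position p a≤p p<b) Mp
      where
      a≡0 : a ≡ 0
      a≡0 with 0 ℕ.<? a
      ... | no a≯0 = ℕP.n≤0⇒n≡0 (ℕP.≮⇒≥ a≯0)
      ... | yes a>0 = ⊥-elim (ℕP.<-irrefl refl (ℕP.<-≤-trans (subst (_< b) b-a≡n (ℕP.∸-monoʳ-< {b} {a} {0} a>0 a≤b)) b≤n))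
      a≤p : a ≤ toℕ p
      a≤p = subst (_≤ toℕ p) (sym a≡0) z≤n
      p<b : toℕ p < b
      p<b = ℕP.<-≤-trans (FP.toℕ<n p) (subst (_≤ b) b-a≡n (ℕP.m∸n≤m b a))

  simple⇒prime : Simple π → Cπ.Prime Cπ.full
  simple⇒prime S M m₀ m₁ p _ M-module Mm₀ Mm₁ m₀≢m₁ _ Mp =
    trivial⇒not-proper Mm₁ m₀≢m₁ Mp (S a b interval)
    where open ModuleInterval M-module Mm₀

-- Simple permutations and the substitution closure

SimplesIn : (Perm → Set) → Perm → Set
SimplesIn C π = ∀ τ → τ ≼ π → Simple τ → ¬ ¬ C τ

SimplesIn-class : ∀ C → IsClass (SimplesIn C)
SimplesIn-class C σ π s d τ t st = d τ (≼-trans {τ} {σ} {π} t s) st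

SimplesIn-⊇ : ∀ C → IsClass C → ∀ σ → C σ → SimplesIn C σ
SimplesIn-⊇ C cl σ Cσ τ t _ k = k (cl τ σ t Cσ)

module InflationPattern {σ : Perm} {α : Fin (len σ) → Perm} {π : Perm} (π-inflation : IsInflation σ α π)
                        {τ : Perm} (τ≼π : τ ≼ π) where
  private
    blk = proj₁ π-inflation
    blk-mono = proj₁ (proj₂ π-inflation)
    blk-cross = proj₁ (proj₂ (proj₂ π-inflation))
    blocks = proj₂ (proj₂ (proj₂ π-inflation))
    h = proj₁ τ≼π
    h-mono = proj₁ (proj₂ τ≼π)
    h-iso = proj₂ (proj₂ τ≼π)

  block : Fin (len τ) → Fin (len σ)
  block i = blk (h i)

  different-blocks : ∀ {i j} → block i ≢ block j →
    (fn τ i F.< fn τ j → fn σ (block i) F.< fn σ (block j)) × (fn σ (block i) F.< fn σ (block j) → fn τ i F.< fn τ j)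
  different-blocks {i} {j} i≁j = (λ lt → proj₁ (blk-cross (h i) (h j) i≁j) (proj₁ (h-iso i j) lt)) ,
                                 (λ lt → proj₂ (h-iso i j) (proj₂ (blk-cross (h i) (h j) i≁j) lt))

  block-mono : ∀ {i j} → toℕ i < toℕ j → block i F.≤ block j
  block-mono {i} {j} i<j = blk-mono (h i) (h j) (ℕP.<⇒≤ (h-mono i j i<j))

  injective-blocks⇒≼σ : (∀ i j → block i ≡ block j → i ≡ j) → τ ≼ σ
  injective-blocks⇒≼σ block-inj = block , increasing , iso
    where
    increasing : ∀ i j → i F.< j → block i F.< block j
    increasing i j i<j = ℕP.≤∧≢⇒< (block-mono i<j) (λ e → ℕP.<-irrefl (cong toℕ (block-inj i j (FP.toℕ-injective e))) i<j)
    iso : ∀ i j → (fn τ i F.< fn τ j → fn σ (block i) F.< fn σ (block j)) × (fn σ (block i) F.< fn σ (block j) → fn τ i F.< fn τ j)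
    iso i j = case-≟ i j (λ { refl → (λ lt → ⊥-elim (ℕP.<-irrefl refl lt)) , (λ lt → ⊥-elim (ℕP.<-irrefl refl lt)) })
                         (λ i≢j → different-blocks (λ e → i≢j (block-inj i j e)))

  one-block⇒≼α : ∀ B → (∀ i → block i ≡ B) → τ ≼ α B
  one-block⇒≼α B in-B = k , increasing , iso
    where
    e = proj₁ (blocks B)
    e-onto = proj₁ (proj₂ (proj₂ (blocks B)))
    e-mono = proj₁ (proj₂ (proj₂ (proj₂ (blocks B))))
    e-iso = proj₂ (proj₂ (proj₂ (proj₂ (blocks B))))
    k : Fin (len τ) → Fin (len (α B))
    k i = proj₁ (e-onto (h i) (in-B i))
    e-k : ∀ i → e (k i) ≡ h i
    e-k i = proj₂ (e-onto (h i) (in-B i))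
    increasing : ∀ i j → i F.< j → k i F.< k j
    increasing i j i<j = strictly-monotone-reflects e e-mono (k i) (k j)
                           (subst₂ (λ x y → x F.< y) (sym (e-k i)) (sym (e-k j)) (h-mono i j i<j))
    iso : ∀ i j → (fn τ i F.< fn τ j → fn (α B) (k i) F.< fn (α B) (k j)) × (fn (α B) (k i) F.< fn (α B) (k j) → fn τ i F.< fn τ j)
    iso i j = (λ lt → proj₂ (e-iso (k i) (k j)) (subst₂ (λ x y → fn π x F.< fn π y) (sym (e-k i)) (sym (e-k j)) (proj₁ (h-iso i j) lt))) ,
              (λ lt → proj₂ (h-iso i j) (subst₂ (λ x y → fn π x F.< fn π y) (e-k i) (e-k j) (proj₁ (e-iso (k i) (k j)) lt)))

  in-block : Fin (len σ) → Fin (len τ) → Bool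
  in-block B q = eqb (block q) B

  -- Every point outside block B compares with the points of B as its block compares with B in σ.
  block-module : ∀ B → PermOrders.IsModule τ (PermOrders.full τ) (in-block B)
  block-module B z m m' _ Bz Bm Bm' = trans (view m Bm) (sym (view m' Bm'))
    where
    z∉B : block z ≢ B
    z∉B e = true≢false (subst (λ t → eqb t B ≡ true) (sym e) (eqb-refl B)) Bz
    view : ∀ m → in-block B m ≡ true → PermOrders.rel τ z m ≡ ((toℕ (block z) <ᵇ toℕ B) , (toℕ (fn σ (block z)) <ᵇ toℕ (fn σ B)))
    view m Bm with eqb-true {p = block m} Bm
    ... | refl = cong₂ _,_ (<ᵇ-cong by-block by-position) (<ᵇ-cong (proj₁ (different-blocks z∉B)) (proj₂ (different-blocks z∉B)))
      where
      by-block : toℕ z < toℕ m → toℕ (block z) < toℕ (block m)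
      by-block z<m = ℕP.≤∧≢⇒< (block-mono z<m) (λ e → z∉B (FP.toℕ-injective e))
      by-position : toℕ (block z) < toℕ (block m) → toℕ z < toℕ m
      by-position z<m with ℕP.<-cmp (toℕ z) (toℕ m)
      ... | tri< lt _ _ = lt
      ... | tri≈ _ eq _ = ⊥-elim (z∉B (cong block (FP.toℕ-injective eq)))
      ... | tri> _ _ gt = ⊥-elim (ℕP.<-irrefl refl (ℕP.<-≤-trans z<m (block-mono gt)))

-- A simple pattern of an inflation lies in σ, in one block, or meets some block in a proper module.
SimplesIn-substClosed : ∀ C → SubstClosed (SimplesIn C)
SimplesIn-substClosed C σ α π σ-ok α-ok _ π-inflation τ τ≼π τ-simple ¬Cτ =
  ¬¬-excluded-middle {A = Σ (Fin (len τ)) λ i → Σ (Fin (len τ)) λ j → (i ≢ j) × (block i ≡ block j)} λ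
  { (no injective) → σ-ok τ (injective-blocks⇒≼σ (λ i j e → case-≟ i j (λ i≡j → i≡j) λ i≢j → ⊥-elim (injective (i , j , i≢j , e))))
                          τ-simple ¬Cτ
  ; (yes (i₀ , i₁ , i₀≢i₁ , same)) → ¬¬-excluded-middle {A = ∃ λ j → block j ≢ block i₀} λ
    { (no one-block) → α-ok (block i₀) τ
                         (one-block⇒≼α (block i₀) λ i → case-≟ (block i) (block i₀) (λ e → e) λ ne → ⊥-elim (one-block (i , ne)))
                         τ-simple ¬Cτ
    ; (yes (j , j∉B)) → Intervals.simple⇒prime τ τ-simple (in-block (block i₀)) i₀ i₁ j (λ _ _ → refl)
                          (block-module (block i₀)) (eqb-refl (block i₀))
                          (subst (λ t → eqb t (block i₀) ≡ true) same (eqb-refl (block i₀))) i₀≢i₁ refl (eqb-false j∉B) } }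
  where open InflationPattern {σ} {α} {π} π-inflation {τ} τ≼π

perm₁ : Perm
perm₁ = perm 1 (λ x → x) (λ e → e)

module NonSimple (β : Perm) (a b c : ℕ) (a≤b : a ≤ b) (b≤n : b ≤ len β) (values : Intervals.ValuesIn β a b c)
            (two : 2 ≤ b ∸ a) (partial : b ∸ a ≢ len β) where
  open Intervals β
  open NontrivialInterval a≤b b≤n two partial
  w = b ∸ a

  inside : Fin n → Bool
  inside = between a b

  -- The positions outside the interval, together with its first position a.
  skeleton : Fin n → Bool
  skeleton q = not ((a <ᵇ toℕ q) ∧ (toℕ q <ᵇ b))

  first∈skeleton : skeleton first ≡ true
  first∈skeleton = not-false (∧-falseˡ (≤⇒<ᵇ≡false {a} {toℕ first} (ℕP.≤-reflexive toℕ-first)))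
  skeleton∩inside : ∀ q → skeleton q ≡ true → inside q ≡ true → q ≡ first
  skeleton∩inside q q∈skeleton q∈inside = FP.toℕ-injective (trans (ℕP.≤-antisym le (proj₁ q-inside)) (sym toℕ-first))
    where
    q-inside = between-elim {a} {b} {q} q∈inside
    le : toℕ q ≤ a
    le = <ᵇ≡false⇒≤ {a} {toℕ q} (bool-case (a <ᵇ toℕ q)
           (λ e → ⊥-elim (true≢false (∧-true e (<⇒<ᵇ≡true (proj₂ q-inside))) (not-true-elim q∈skeleton))) (λ e → e))
  outside⇒skeleton : ∀ q → inside q ≡ false → skeleton q ≡ true
  outside⇒skeleton q q∈inside with between-false {a} {b} {q} q∈inside
  ... | inj₁ x = not-false (∧-falseˡ (≤⇒<ᵇ≡false {a} {toℕ q} (ℕP.<⇒≤ x)))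
  ... | inj₂ y = not-false (∧-falseʳ {a <ᵇ toℕ q} (≤⇒<ᵇ≡false {toℕ q} {b} y))

  rep : Fin n → Fin n
  rep q = if inside q then first else q
  rep-inside : ∀ {q} → inside q ≡ true → rep q ≡ first
  rep-inside {q} e rewrite e = refl
  rep-outside : ∀ {q} → inside q ≡ false → rep q ≡ q
  rep-outside {q} e rewrite e = refl
  rep∈skeleton : ∀ q → skeleton (rep q) ≡ true
  rep∈skeleton q = bool-case (inside q) (λ e → subst (λ t → skeleton t ≡ true) (sym (rep-inside e)) first∈skeleton)
                       (λ e → subst (λ t → skeleton t ≡ true) (sym (rep-outside e)) (outside⇒skeleton q e))

  module Skeleton = RestrictionOf β skeleton
  module Inside = RestrictionOf β inside
  σ : Perm
  σ = Skeleton.restriction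
  skeleton-at = enum skeleton

  block : Fin n → Fin (len σ)
  block q = proj₁ (enum-surj skeleton (rep q) (rep∈skeleton q))
  skeleton-at-block : ∀ q → skeleton-at (block q) ≡ rep q
  skeleton-at-block q = proj₂ (enum-surj skeleton (rep q) (rep∈skeleton q))

  α : Fin (len σ) → Perm
  α i = if eqb (skeleton-at i) first then Inside.restriction else perm₁

  rep-mono : ∀ p q → toℕ p ≤ toℕ q → toℕ (rep p) ≤ toℕ (rep q)
  rep-mono p q le = bool-case (inside p) (λ ep → bool-case (inside q) (λ eq → tt' ep eq) (λ eq → tf ep eq))
                                         (λ ep → bool-case (inside q) (λ eq → ft ep eq) (λ eq → ff ep eq))
    where
    tt' : inside p ≡ true → inside q ≡ true → toℕ (rep p) ≤ toℕ (rep q)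
    tt' ep eq rewrite rep-inside ep | rep-inside eq = ℕP.≤-refl
    tf : inside p ≡ true → inside q ≡ false → toℕ (rep p) ≤ toℕ (rep q)
    tf ep eq rewrite rep-inside ep | rep-outside eq = subst (_≤ toℕ q) (sym toℕ-first) (ℕP.≤-trans (proj₁ (between-elim {a} {b} {p} ep)) le)
    ft : inside p ≡ false → inside q ≡ true → toℕ (rep p) ≤ toℕ (rep q)
    ft ep eq rewrite rep-outside ep | rep-inside eq with between-false {a} {b} {p} ep
    ... | inj₁ x = subst (toℕ p ≤_) (sym toℕ-first) (ℕP.<⇒≤ x)
    ... | inj₂ y = ⊥-elim (ℕP.<-irrefl refl (ℕP.<-≤-trans (proj₂ (between-elim {a} {b} {q} eq)) (ℕP.≤-trans y le)))
    ff : inside p ≡ false → inside q ≡ false → toℕ (rep p) ≤ toℕ (rep q)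
    ff ep eq rewrite rep-outside ep | rep-outside eq = le

  block-mono : ∀ p q → p F.≤ q → block p F.≤ block q
  block-mono p q le = ℕP.≮⇒≥ λ lt → ℕP.<-irrefl refl (ℕP.<-≤-trans (subst₂' (enum-mono skeleton (block q) (block p) lt)) (rep-mono p q le))
    where
    subst₂' : toℕ (skeleton-at (block q)) < toℕ (skeleton-at (block p)) → toℕ (rep q) < toℕ (rep p)
    subst₂' x = subst (λ t → toℕ (rep q) < toℕ t) (skeleton-at-block p) (subst (λ t → toℕ t < toℕ (skeleton-at (block p))) (skeleton-at-block q) x)

  inside-values : ∀ x → inside x ≡ true → (c ≤ val x) × (val x < c + w)
  inside-values x Ix = values x (proj₁ (between-elim {a} {b} {x} Ix)) (proj₂ (between-elim {a} {b} {x} Ix))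

  below-outside : ∀ x y q → inside x ≡ true → inside y ≡ true → inside q ≡ false → val x < val q → val y < val q
  below-outside x y q Ix Iy q∈inside lt with c ℕ.≤? val q
  ... | no nc = ⊥-elim (ℕP.<-irrefl refl (ℕP.<-trans lt (ℕP.<-≤-trans (ℕP.≰⇒> nc) (proj₁ (inside-values x Ix)))))
  ... | yes cq with val q ℕ.<? c + w
  ... | yes ql = ⊥-elim (values-outside a b c a≤b b≤n values q (between-false {a} {b} {q} q∈inside) cq ql)
  ... | no ql = ℕP.<-≤-trans (proj₂ (inside-values y Iy)) (ℕP.≮⇒≥ ql)

  above-outside : ∀ x y q → inside x ≡ true → inside y ≡ true → inside q ≡ false → val q < val x → val q < val y
  above-outside x y q Ix Iy q∈inside lt with c ℕ.≤? val q
  ... | no nc = ℕP.<-≤-trans (ℕP.≰⇒> nc) (proj₁ (inside-values y Iy))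
  ... | yes cq with val q ℕ.<? c + w
  ... | yes ql = ⊥-elim (values-outside a b c a≤b b≤n values q (between-false {a} {b} {q} q∈inside) cq ql)
  ... | no ql = ⊥-elim (ℕP.<-irrefl refl (ℕP.<-trans lt (ℕP.<-≤-trans (proj₂ (inside-values x Ix)) (ℕP.≮⇒≥ ql))))

  rep-preserves-order : ∀ p q → rep p ≢ rep q → (val p < val q → val (rep p) < val (rep q)) × (val (rep p) < val (rep q) → val p < val q)
  rep-preserves-order p q rep≢ = bool-case (inside p) (λ ep → bool-case (inside q) (λ eq → tt' ep eq) (λ eq → tf ep eq))
                                                     (λ ep → bool-case (inside q) (λ eq → ft ep eq) (λ eq → ff ep eq))
    where
    R = (val p < val q → val (rep p) < val (rep q)) × (val (rep p) < val (rep q) → val p < val q)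
    tt' : inside p ≡ true → inside q ≡ true → R
    tt' ep eq = ⊥-elim (rep≢ (trans (rep-inside ep) (sym (rep-inside eq))))
    tf : inside p ≡ true → inside q ≡ false → R
    tf ep eq rewrite rep-inside ep | rep-outside eq = below-outside p first q ep first∈ eq , below-outside first p q first∈ ep eq
    ft : inside p ≡ false → inside q ≡ true → R
    ft ep eq rewrite rep-outside ep | rep-inside eq = above-outside q first p eq first∈ ep , above-outside first q p first∈ eq ep
    ff : inside p ≡ false → inside q ≡ false → R
    ff ep eq rewrite rep-outside ep | rep-outside eq = (λ x → x) , (λ x → x)

  block-cross : ∀ p q → block p ≢ block q → (fn β p F.< fn β q → fn σ (block p) F.< fn σ (block q)) ×
                                  (fn σ (block p) F.< fn σ (block q) → fn β p F.< fn β q)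
  block-cross p q ne = (λ lt → Skeleton.iso→ (block p) (block q) (to (proj₁ (rep-preserves-order p q rep≢) lt))) ,
                 (λ lt → proj₂ (rep-preserves-order p q rep≢) (from (Skeleton.iso← (block p) (block q) lt)))
    where
    rep≢ : rep p ≢ rep q
    rep≢ e = ne (enum-inj skeleton (trans (skeleton-at-block p) (trans e (sym (skeleton-at-block q)))))
    to : val (rep p) < val (rep q) → val (skeleton-at (block p)) < val (skeleton-at (block q))
    to x = subst (λ t → val (skeleton-at (block p)) < val t) (sym (skeleton-at-block q)) (subst (λ t → val t < val (rep q)) (sym (skeleton-at-block p)) x)
    from : val (skeleton-at (block p)) < val (skeleton-at (block q)) → val (rep p) < val (rep q)
    from x = subst (λ t → val (rep p) < val t) (skeleton-at-block q) (subst (λ t → val t < val (skeleton-at (block q))) (skeleton-at-block p) x)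

  Block : Fin (len σ) → Set
  Block i = Σ (Fin (len (α i)) → Fin (len β)) λ e →
        (∀ j → block (e j) ≡ i) ×
        (∀ p → block p ≡ i → ∃ λ j → e j ≡ p) ×
        (∀ j j' → j F.< j' → e j F.< e j') ×
        (∀ j j' → (fn (α i) j F.< fn (α i) j' → fn β (e j) F.< fn β (e j')) ×
                  (fn β (e j) F.< fn β (e j') → fn (α i) j F.< fn (α i) j'))

  block-of : ∀ q i → rep q ≡ skeleton-at i → block q ≡ i
  block-of q i e = enum-inj skeleton (trans (skeleton-at-block q) e)

  blocks : ∀ i → Block i
  blocks i with eqb (skeleton-at i) first in eq
  ... | true = enum inside , lands-in-i , covers-i , (λ j j' lt → enum-mono inside j j' lt) , (λ j j' → Inside.iso← j j' , Inside.iso→ j j')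
    where
    at-first : skeleton-at i ≡ first
    at-first = eqb-true eq
    lands-in-i : ∀ j → block (enum inside j) ≡ i
    lands-in-i j = block-of (enum inside j) i (trans (rep-inside (enum-in inside j)) (sym at-first))
    covers-i : ∀ p → block p ≡ i → ∃ λ j → enum inside j ≡ p
    covers-i p e = bool-case (inside p) (λ Ip → enum-surj inside p Ip)
                  (λ Ip → ⊥-elim (true≢false (subst (λ t → inside t ≡ true) (sym (block-point Ip)) first∈) Ip))
      where
      block-point : inside p ≡ false → p ≡ first
      block-point Ip = trans (sym (rep-outside Ip)) (trans (sym (skeleton-at-block p)) (trans (cong skeleton-at e) at-first))
  ... | false = (λ _ → skeleton-at i) , lands-in-i , covers-i , (λ { F.zero F.zero () }) ,
                (λ { F.zero F.zero → (λ ()) , (λ lt → ⊥-elim (ℕP.<-irrefl refl lt)) })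
    where
    not-at-first : skeleton-at i ≢ first
    not-at-first e = true≢false (subst (λ t → eqb t first ≡ true) (sym e) (eqb-refl first)) eq
    outside-i : inside (skeleton-at i) ≡ false
    outside-i = bool-case (inside (skeleton-at i)) (λ e → ⊥-elim (not-at-first (skeleton∩inside (skeleton-at i) (enum-in skeleton i) e))) (λ e → e)
    lands-in-i : ∀ j → block (skeleton-at i) ≡ i
    lands-in-i j = block-of (skeleton-at i) i (rep-outside outside-i)
    covers-i : ∀ p → block p ≡ i → ∃ λ j → skeleton-at i ≡ p
    covers-i p e = F.zero , bool-case (inside p) (λ Ip → ⊥-elim (not-at-first (trans (sym rep≡) (rep-inside Ip)))) (λ Ip → trans (sym rep≡) (rep-outside Ip))
      where
      rep≡ : rep p ≡ skeleton-at i
      rep≡ = trans (sym (skeleton-at-block p)) (cong skeleton-at e)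

  inflation : IsInflation σ α β
  inflation = block , block-mono , block-cross , blocks

  perm₁≼ : perm₁ ≼ β
  perm₁≼ = (λ _ → first) , (λ { F.zero F.zero () }) , (λ { F.zero F.zero → (λ ()) , (λ lt → ⊥-elim (ℕP.<-irrefl refl lt)) })

  second∉skeleton : skeleton second ≡ false
  second∉skeleton = not-true (∧-true (<⇒<ᵇ≡true (subst (a <_) (sym toℕ-second) (ℕP.n<1+n a)))
                          (<⇒<ᵇ≡true (subst (_< b) (sym toℕ-second) a+1<b)))

  σ-shorter : len σ < n
  σ-shorter = ℕP.<-≤-trans (count-strict skeleton (λ _ → true) (λ _ _ → refl) second second∉skeleton refl) (count≤size _)

  inside-shorter : len Inside.restriction < n
  inside-shorter = ℕP.<-≤-trans (count-strict inside (λ _ → true) (λ _ _ → refl) (proj₁ outside) (proj₂ outside) refl) (count≤size _)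

  inside-nonempty : 0 < len Inside.restriction
  inside-nonempty = ℕP.≤-<-trans (ℕP.≤-reflexive (sym (count-empty {n}))) (count-strict (λ _ → false) inside (λ _ ()) first refl first∈)

  1<n : 1 < n
  1<n = ℕP.≤-<-trans (s≤s z≤n) (subst (_< n) toℕ-second (FP.toℕ<n second))

  inflation∈closure : (C : Perm → Set) → (∀ γ → γ ≼ β → len γ < len β → SubstClosure C γ) → SubstClosure C β
  inflation∈closure C shorter∈ D D-class D-subst C⊆D = D-subst σ α β (shorter∈ σ Skeleton.restriction≼ σ-shorter D D-class D-subst C⊆D) α∈D α-nonempty inflation
    where
    α∈D : ∀ i → D (α i)
    α∈D i with eqb (skeleton-at i) first
    ... | true = shorter∈ Inside.restriction Inside.restriction≼ inside-shorter D D-class D-subst C⊆D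
    ... | false = shorter∈ perm₁ perm₁≼ 1<n D D-class D-subst C⊆D
    α-nonempty : ∀ i → 0 < len (α i)
    α-nonempty i with eqb (skeleton-at i) first
    ... | true = inside-nonempty
    ... | false = s≤s z≤n

basis⇒simple : ∀ {C β} → InBasis (SubstClosure C) β → Simple β
basis⇒simple {C} {β} (β∉ , shorter∈) a b (a≤b , b≤n , c , values) with b ∸ a ℕ.≤? 1 | b ∸ a ℕ.≟ len β
... | yes small | _ = inj₁ small
... | no _ | yes whole = inj₂ whole
... | no big | no partial =
  ⊥-elim (β∉ (NonSimple.inflation∈closure β a b c a≤b b≤n values (ℕP.≰⇒> big) partial C shorter∈))

simple∈closure⇒∈C : ∀ {C} → IsClass C → ∀ {γ} → SubstClosure C γ → Simple γ → ¬ ¬ C γ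
simple∈closure⇒∈C {C} C-class {γ} γ∈ γ-simple =
  γ∈ (SimplesIn C) (SimplesIn-class C) (SimplesIn-substClosed C) (SimplesIn-⊇ C C-class) γ (≼-refl γ) γ-simple

mainTheorem2 : (C : Perm → Set) → IsClass C → (k : ℕ) → LongestSimpleLength C k →
    ∀ β → InBasis (SubstClosure C) β → len β ≤ k + 2
mainTheorem2 C C-class k (_ , longest) β basis with len β ℕ.≤? k + 2
... | yes short = short
... | no long = ⊥-elim (SchmerlTrotter.prime-subset-larger-than (lowerᵇ β) (lower-order β)
                          (Intervals.simple⇒prime β (basis⇒simple basis)) k (ℕP.≰⇒> long) too-long)
  where
  too-long : ¬ (Σ (Fin (len β) → Bool) λ Y → PermOrders.Prime β Y × (∃ λ w → Y w ≡ false) × k < count Y)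
  too-long (Y , Y-prime , (w , Yw) , k<Y) =
    simple∈closure⇒∈C C-class (proj₂ basis γ restriction≼ (restriction-shorter Yw)) γ-simple
      λ γ∈C → ℕP.<-irrefl refl (ℕP.<-≤-trans k<Y (longest γ γ∈C γ-simple))
    where
    open RestrictionOf β Y
    γ = restriction
    γ-simple : Simple γ
    γ-simple = Intervals.prime⇒simple γ (prime-restriction Y-prime)
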